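{- Let $M=p_1^{n_1}\cdots p_d^{n_d}$ with $p_1,\dots,p_d$ distinct primes and $n_i\in\mathbb{N}$. For $x\in\mathbb{Z}_M$ let $\Pi_d(x)=\{y\in\mathbb{Z}_M: p_d^{n_d}\mid (x-y)\}$, and for a set $A\subset\mathbb{Z}_M$ let $m_A=\min_{a\in A}|A\cap\Pi_d(a)|$. Let $A\oplus B=\mathbb{Z}_M$ be a tiling, and assume $p_d>\max(m_A,m_B)$. Then $M/p_d\in\mathrm{Div}(A)\cup\mathrm{Div}(B)$.
   Context: $A\oplus B=\mathbb{Z}_M$ (a tiling) means every element of $\mathbb{Z}_M$ can be written uniquely as $a+b\bmod M$ with $a\in A$, $b\in B$. For integers $m,n$, $(m,n)$ is their gcd, and $\mathrm{Div}(A)=\{(a-a',M): a,a'\in A\}$ (elements of $\mathbb{Z}_M$ represented by integers). -}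

module Defs where

open import Data.Nat using (ℕ; zero; suc; _+_; _*_; _^_; _⊓_; ∣_-_∣; NonZero)
open import Data.Nat.DivMod using (_%_)
open import Data.Nat.Divisibility using (_∣_; _∣?_)
open import Data.Fin using (Fin; toℕ)
open import Data.Fin.Subset using (Subset; _∈_; _∩_; ∣_∣)
open import Data.Fin.Subset.Properties using (_∈?_)
open import Data.Vec using (tabulate)
open import Data.List using (List; []; _∷_; map; filter; allFin)
open import Data.Product using (Σ; _×_; ∃-syntax)
open import Relation.Binary.PropositionalEquality using (_≡_)
open import Relation.Nullary.Decidable using (does)

prodFin : (d : ℕ) → (Fin d → ℕ) → ℕ
prodFin zero    f = 1
prodFin (suc d) f = f Fin.zero * prodFin d (λ i → f (Fin.suc i))

-- minimum of a list of naturals (0 for the empty list; never used on empty lists below)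
minList : List ℕ → ℕ
minList []       = 0
minList (x ∷ []) = x
minList (x ∷ y ∷ xs) = x ⊓ minList (y ∷ xs)

-- Π(x) = { y ∈ ℤ_M : q ∣ (x - y) }, here q = p_d ^ n_d  (x, y represented by 0..M-1)
Π : {M : ℕ} → (q : ℕ) → Fin M → Subset M
Π q x = tabulate (λ y → does (q ∣? ∣ toℕ x - toℕ y ∣))

mSet : {M : ℕ} → (q : ℕ) → Subset M → ℕ
mSet {M} q A = minList (map (λ a → ∣ A ∩ Π q a ∣) (filter (λ a → a ∈? A) (allFin M)))

Tiling : (M : ℕ) → .{{NonZero M}} → Subset M → Subset M → Set
Tiling M A B = (z : Fin M) →
  (∃[ a ] ∃[ b ] (a ∈ A × b ∈ B × (toℕ a + toℕ b) % M ≡ toℕ z))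
  × ((a a' b b' : Fin M) → a ∈ A → a' ∈ A → b ∈ B → b' ∈ B →
       (toℕ a + toℕ b) % M ≡ toℕ z → (toℕ a' + toℕ b') % M ≡ toℕ z →
       (a ≡ a' × b ≡ b'))

InDiv : (M : ℕ) → Subset M → ℕ → Set
InDiv M A t = ∃[ a ] ∃[ a' ] (a ∈ A × a' ∈ A × Data.Nat.GCD.gcd ∣ toℕ a - toℕ a' ∣ M ≡ t)
  where import Data.Nat.GCD

{-# OPTIONS --safe #-}
-- Put N = M/p_d and Q = p_d^{n_d}, and pick a₀ ∈ A, b₀ ∈ B attaining m_A and m_B. Use the tiling to
-- write a₀ + b₀ + jN = a_j + b_j for 0 ≤ j < p_d. If N ∉ Div(A) ∪ Div(B), the a_j are pairwise distinct,
-- and so are the b_j. For k < j the differences a_j − a_k and b_k − b_j add up to (j − k)N, so if neither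
-- were divisible by Q they would have the same gcd with M, which Sands' theorem Div(A) ∩ Div(B) = {M}
-- forbids. Hence every pair j, k has a_j ≡ a_k or b_j ≡ b_k (mod Q); both relations are equivalences,
-- so one of them is total, and A ∩ Π(a₀) or B ∩ Π(b₀) has p_d elements, against p_d > max(m_A, m_B).
--
-- Sands' theorem comes from Tijdeman's dilation theorem (wA ⊕ B = ℤ_M when gcd(w, |A|) = 1): if
-- (a − a′, M) = (b − b′, M) then some unit w has w(a − a′) ≡ ±(b − b′) (mod M), and two sums of wA ⊕ B
-- coincide. Tijdeman's theorem rests on the Frobenius congruence A(X)^p ≡ A(X^p) (mod p) in ℕ[ℤ_M].
module Submission where

open import Defs

open import Algebra.Bundles using (CommutativeSemiring)
open import Algebra.Structures using (IsCommutativeSemiring)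
open import Data.Bool using (true; false; if_then_else_)
open import Data.Empty using (⊥)
open import Data.Fin as Fin using (Fin; zero; suc; toℕ; fromℕ; fromℕ<; inject₁)
open import Data.Fin.Properties
  using (toℕ-fromℕ; toℕ-fromℕ<; toℕ-inject₁; toℕ<n; toℕ-injective; all?; any?; ¬∀⟶∃¬; injective⇒≤)
open import Data.Fin.Subset using (Subset; _∩_; ∣_∣) renaming (_∈_ to _∈ₛ_)
open import Data.Fin.Subset.Properties using (_∈?_; x∈p∩q⁺)
open import Data.List using (List; []; _∷_; _++_; map; length; upTo; filter; allFin; lookup; tabulate)
open import Data.List.Membership.Propositional using (_∈_)
open import Data.List.Membership.Propositional.Properties
  using (∈-upTo⁺; ∈-upTo⁻; ∈-filter⁺; ∈-filter⁻; ∈-map⁺; ∈-map⁻; ∈-allFin)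
open import Data.List.Properties
  using (map-tabulate; map-id; length-map; length-++; length-upTo; upTo-∷ʳ; map-upTo; map-∘; map-cong; ++-assoc; ++-identityʳ)
open import Data.List.Relation.Unary.All as All using (All; []; _∷_)
import Data.List.Relation.Unary.All.Properties as All
open import Data.List.Relation.Unary.AllPairs using ([]; _∷_)
open import Data.List.Relation.Unary.Any using (here; there; index)
open import Data.List.Relation.Unary.Any.Properties using (lookup-index)
open import Data.List.Relation.Unary.Unique.Propositional using (Unique)
open import Data.List.Relation.Unary.Unique.Propositional.Properties
  using (upTo⁺; allFin⁺) renaming (filter⁺ to unique-filter⁺)
open import Data.Nat
  using (ℕ; zero; suc; _+_; _*_; _^_; _∸_; _!; _<_; _≤_; _⊔_; _<?_; _≟_; ∣_-_∣; z≤n; z<s; s<s;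
         NonZero; >-nonZero; >-nonZero⁻¹; ≢-nonZero; ≢-nonZero⁻¹; nonTrivial⇒≢1)
open import Data.Nat.Properties
open import Data.Nat.Coprimality using (prime⇒coprime; coprime⇒gcd≡1)
open import Data.Nat.Combinatorics using (_C_; nCn≡1; nCk≡n!/k![n-k]!; k![n∸k]!∣n!)
open import Data.Nat.Divisibility
open import Data.Nat.DivMod hiding (_mod_)
open import Data.Nat.GCD
open import Data.Nat.ListAction using (product)
open import Data.Nat.ListAction.Properties using (∈⇒∣product)
open import Data.Nat.Primality
  using (Prime; euclidsLemma; productOfPrimes≢0; prime⇒nonZero; prime⇒nonTrivial)
open import Data.Nat.Primality.Factorisation
  using (factorisationHasAllPrimeFactors; factorise; factors; PrimeFactorisation)
open PrimeFactorisation using (isFactorisation; factorsPrime)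
open import Data.Nat.Solver using (module +-*-Solver)
open import Data.Product using (∃-syntax; _×_; _,_; proj₁; proj₂)
open import Data.Sum as Sum using (_⊎_; inj₁; inj₂)
open import Data.Vec using ([]; _∷_)
open import Data.Vec.Functional using (Vector)
open import Data.Vec.Properties using (lookup∘tabulate; lookup⇒[]=)
open import Function using (_∘_; id)
open import Function.Definitions using (Injective)
open import Level using (0ℓ)
open import Relation.Binary.Definitions using (DecidableEquality; tri<; tri≈; tri>)
open import Relation.Binary.PropositionalEquality
  using (_≡_; _≢_; refl; sym; trans; cong; cong₂; subst; subst₂; module ≡-Reasoning)
open import Relation.Binary.Structures using (IsEquivalence)
open import Relation.Nullary using (¬_; ¬?; yes; no; Dec; does; contradiction)
open import Relation.Nullary.Decidable using (dec-true; dec-false; _×-dec_)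

open import Algebra.Properties.Monoid.Sum +-0-monoid using (sum-init-last) renaming (sum to sumⱽ)
open import Algebra.Properties.CommutativeSemigroup +-commutativeSemigroup
  using (interchange; x∙yz≈xz∙y; xy∙z≈xz∙y; xy∙z≈zx∙y)

open ≡-Reasoning

∑ : {X : Set} → List X → (X → ℕ) → ℕ
∑ []       f = 0
∑ (x ∷ xs) f = f x + ∑ xs f

infix 6.5 ∑
syntax ∑ xs (λ x → e) = ∑[ x ∈ xs ] e

private
  variable
    X Y : Set

∑-++ : ∀ (xs ys : List X) f → ∑ (xs ++ ys) f ≡ ∑ xs f + ∑ ys f
∑-++ []       ys f = refl
∑-++ (x ∷ xs) ys f = trans (cong (f x +_) (∑-++ xs ys f)) (sym (+-assoc (f x) _ _))

∑-cong : ∀ (xs : List X) {f g} → (∀ x → f x ≡ g x) → ∑ xs f ≡ ∑ xs g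
∑-cong []       f≗g = refl
∑-cong (x ∷ xs) f≗g = cong₂ _+_ (f≗g x) (∑-cong xs f≗g)

∑-distrib-+ : ∀ (xs : List X) f g → ∑[ x ∈ xs ] (f x + g x) ≡ ∑ xs f + ∑ xs g
∑-distrib-+ []       f g = refl
∑-distrib-+ (x ∷ xs) f g =
  trans (cong (f x + g x +_) (∑-distrib-+ xs f g)) (interchange (f x) (g x) (∑ xs f) (∑ xs g))

∑-zero : ∀ (xs : List X) {f} → (∀ {x} → x ∈ xs → f x ≡ 0) → ∑ xs f ≡ 0
∑-zero []       f≡0 = refl
∑-zero (x ∷ xs) f≡0 = cong₂ _+_ (f≡0 (here refl)) (∑-zero xs (f≡0 ∘ there))

∑-const : ∀ (xs : List X) c → ∑[ x ∈ xs ] c ≡ length xs * c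
∑-const []       c = refl
∑-const (_ ∷ xs) c = cong (c +_) (∑-const xs c)

∑-comm : ∀ (xs : List X) (ys : List Y) (f : X → Y → ℕ) →
         ∑[ x ∈ xs ] ∑[ y ∈ ys ] f x y ≡ ∑[ y ∈ ys ] ∑[ x ∈ xs ] f x y
∑-comm []       ys f = sym (∑-zero ys (λ _ → refl))
∑-comm (x ∷ xs) ys f = begin
  ∑ ys (f x) + ∑[ x ∈ xs ] ∑ ys (f x)          ≡⟨ cong (∑ ys (f x) +_) (∑-comm xs ys f) ⟩
  ∑ ys (f x) + ∑[ y ∈ ys ] ∑[ x ∈ xs ] f x y   ≡⟨ sym (∑-distrib-+ ys (f x) _) ⟩
  ∑[ y ∈ ys ] (f x y + ∑[ x ∈ xs ] f x y)      ∎

∈⇒≤∑ : ∀ {xs : List X} {x} f → x ∈ xs → f x ≤ ∑ xs f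
∈⇒≤∑ {xs = y ∷ xs} f (here refl) = m≤m+n (f y) _
∈⇒≤∑ {xs = y ∷ xs} f (there x∈) = ≤-trans (∈⇒≤∑ f x∈) (m≤n+m _ (f y))

∈₂⇒≤∑ : ∀ {xs : List X} {x x′} f → x ∈ xs → x′ ∈ xs → x ≢ x′ → f x + f x′ ≤ ∑ xs f
∈₂⇒≤∑ f (here refl)  (here refl)  x≢x′ = contradiction refl x≢x′
∈₂⇒≤∑ f (here refl)  (there x′∈) x≢x′ = +-monoʳ-≤ _ (∈⇒≤∑ f x′∈)
∈₂⇒≤∑ {xs = x′ ∷ xs} {x} f (there x∈) (here refl) x≢x′ =
  subst (_≤ f x′ + ∑ xs f) (+-comm (f x′) (f x)) (+-monoʳ-≤ (f x′) (∈⇒≤∑ f x∈))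
∈₂⇒≤∑ {xs = y ∷ _} f (there x∈) (there x′∈) x≢x′ = ≤-trans (∈₂⇒≤∑ f x∈ x′∈ x≢x′) (m≤n+m _ (f y))

∑-single : ∀ {xs : List X} {x} f → Unique xs → x ∈ xs →
           (∀ {y} → y ∈ xs → y ≢ x → f y ≡ 0) → ∑ xs f ≡ f x
∑-single f (x∉xs ∷ _) (here refl) vanish =
  trans (cong (f _ +_) (∑-zero _ (λ y∈ → vanish (there y∈) (All.lookup x∉xs y∈ ∘ sym)))) (+-identityʳ _)
∑-single f (y∉xs ∷ uniq) (there x∈) vanish =
  cong₂ _+_ (vanish (here refl) (All.lookup y∉xs x∈)) (∑-single f uniq x∈ (vanish ∘ there))

∑-map : ∀ (g : X → Y) xs f → ∑ (map g xs) f ≡ ∑ xs (f ∘ g)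
∑-map g []       f = refl
∑-map g (x ∷ xs) f = cong (f (g x) +_) (∑-map g xs f)

∑-rotate : ∀ n (f : ℕ → ℕ) → f n ≡ f 0 → ∑[ y ∈ upTo n ] f (suc y) ≡ ∑[ y ∈ upTo n ] f y
∑-rotate n f fn≡f0 = +-cancelʳ-≡ (f 0) _ _ (begin
  ∑[ y ∈ upTo n ] f (suc y) + f 0          ≡⟨ +-comm _ (f 0) ⟩
  f 0 + ∑[ y ∈ upTo n ] f (suc y)          ≡⟨ cong (f 0 +_) (∑-map suc (upTo n) f) ⟨
  f 0 + ∑ (map suc (upTo n)) f             ≡⟨ cong (λ ys → f 0 + ∑ ys f) (map-upTo suc n) ⟩
  ∑ (upTo (suc n)) f                       ≡⟨ cong (λ ys → ∑ ys f) (upTo-∷ʳ n) ⟨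
  ∑ (upTo n ++ n ∷ []) f                   ≡⟨ ∑-++ (upTo n) (n ∷ []) f ⟩
  ∑ (upTo n) f + (f n + 0)                 ≡⟨ cong (λ t → ∑ (upTo n) f + t) (trans (+-identityʳ (f n)) fn≡f0) ⟩
  ∑ (upTo n) f + f 0                       ∎)

length≤∑ : ∀ (xs : List X) f → (∀ {x} → x ∈ xs → f x ≢ 0) → length xs ≤ ∑ xs f
length≤∑ []       f f≢0 = z≤n
length≤∑ (x ∷ xs) f f≢0 = +-mono-≤ (n≢0⇒n>0 (f≢0 (here refl))) (length≤∑ xs f (f≢0 ∘ there))

∑≡length⇒≡1 : ∀ (xs : List X) f → (∀ {x} → x ∈ xs → f x ≢ 0) → ∑ xs f ≡ length xs →
              ∀ {x} → x ∈ xs → f x ≡ 1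
∑≡length⇒≡1 (y ∷ xs) f f≢0 ∑≡ x∈ with length≤∑ xs f (f≢0 ∘ there) | n≢0⇒n>0 (f≢0 (here refl))
... | len≤∑ | 1≤fy with x∈
...   | here refl = ≤-antisym (+-cancelʳ-≤ (∑ xs f) (f y) 1 (≤-trans (≤-reflexive ∑≡) (+-monoʳ-≤ 1 len≤∑))) 1≤fy
...   | there x∈xs = ∑≡length⇒≡1 xs f (f≢0 ∘ there) ∑xs≡ x∈xs
  where
  ∑xs≡ : ∑ xs f ≡ length xs
  ∑xs≡ = ≤-antisym (+-cancelˡ-≤ 1 (∑ xs f) (length xs) (≤-trans (+-monoˡ-≤ (∑ xs f) 1≤fy) (≤-reflexive ∑≡))) len≤∑

infix 4 _≡_mod_
_≡_mod_ : ℕ → ℕ → (m : ℕ) .{{_ : NonZero m}} → Set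
x ≡ y mod m = x % m ≡ y % m

module _ {m : ℕ} .{{_ : NonZero m}} where

  %-≡-mod : ∀ x → x % m ≡ x mod m
  %-≡-mod x = m%n%n≡m%n x m

  +-cong-mod : ∀ {x x′ y y′} → x ≡ x′ mod m → y ≡ y′ mod m → x + y ≡ x′ + y′ mod m
  +-cong-mod {x} {x′} {y} {y′} x≡x′ y≡y′ = begin
    (x + y) % m             ≡⟨ %-distribˡ-+ x y m ⟩
    (x % m + y % m) % m     ≡⟨ cong₂ (λ a b → (a + b) % m) x≡x′ y≡y′ ⟩
    (x′ % m + y′ % m) % m   ≡⟨ %-distribˡ-+ x′ y′ m ⟨
    (x′ + y′) % m           ∎

  *-congˡ-mod : ∀ c {x y} → x ≡ y mod m → c * x ≡ c * y mod m
  *-congˡ-mod c {x} {y} x≡y = begin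
    (c * x) % m             ≡⟨ %-distribˡ-* c x m ⟩
    (c % m * (x % m)) % m   ≡⟨ cong (λ a → (c % m * a) % m) x≡y ⟩
    (c % m * (y % m)) % m   ≡⟨ %-distribˡ-* c y m ⟨
    (c * y) % m             ∎

  *-congʳ-mod : ∀ c {x y} → x ≡ y mod m → x * c ≡ y * c mod m
  *-congʳ-mod c {x} {y} x≡y = subst₂ (λ a b → a ≡ b mod m) (*-comm c x) (*-comm c y) (*-congˡ-mod c x≡y)

  ∑-cong-mod : ∀ (xs : List X) {f g : X → ℕ} → (∀ x → f x ≡ g x mod m) → ∑ xs f ≡ ∑ xs g mod m
  ∑-cong-mod []       f≡g = refl
  ∑-cong-mod (x ∷ xs) f≡g = +-cong-mod (f≡g x) (∑-cong-mod xs f≡g)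

  ≡-mod⇒∣∣-∣ : ∀ {x y} → x ≡ y mod m → m ∣ ∣ x - y ∣
  ≡-mod⇒∣∣-∣ {x} {y} x≡y = divides ∣ x / m - y / m ∣ (begin
    ∣ x - y ∣                                   ≡⟨ cong₂ ∣_-_∣ (m≡m%n+[m/n]*n x m) (m≡m%n+[m/n]*n y m) ⟩
    ∣ x % m + x / m * m - y % m + y / m * m ∣   ≡⟨ cong (λ r → ∣ x % m + x / m * m - r + y / m * m ∣) x≡y ⟨
    ∣ x % m + x / m * m - x % m + y / m * m ∣   ≡⟨ ∣m+n-m+o∣≡∣n-o∣ (x % m) _ _ ⟩
    ∣ x / m * m - y / m * m ∣                   ≡⟨ *-distribʳ-∣-∣ m (x / m) (y / m) ⟨
    ∣ x / m - y / m ∣ * m                       ∎)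

  ∣∸⇒≡-mod : ∀ {x y} → x ≤ y → m ∣ y ∸ x → x ≡ y mod m
  ∣∸⇒≡-mod {x} {y} x≤y (divides k y∸x≡k*m) =
    trans (sym ([m+kn]%n≡m%n x k m)) (cong (_% m) (trans (cong (x +_) (sym y∸x≡k*m)) (m+[n∸m]≡n x≤y)))

  ∣∣-∣⇒≡-mod : ∀ {x y} → m ∣ ∣ x - y ∣ → x ≡ y mod m
  ∣∣-∣⇒≡-mod {x} {y} m∣d with ≤-total y x
  ... | inj₁ y≤x = sym (∣∸⇒≡-mod y≤x (subst (m ∣_) (m≤n⇒∣n-m∣≡n∸m y≤x) m∣d))
  ... | inj₂ x≤y = ∣∸⇒≡-mod x≤y (subst (m ∣_) (m≤n⇒∣m-n∣≡n∸m x≤y) m∣d)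

  +-cancelˡ-mod : ∀ c {x y : ℕ} → c + x ≡ c + y mod m → x ≡ y mod m
  +-cancelˡ-mod c {x} {y} eq = ∣∣-∣⇒≡-mod (subst (m ∣_) (∣m+n-m+o∣≡∣n-o∣ c x y) (≡-mod⇒∣∣-∣ eq))

  ∣-resp-mod : ∀ {d x y} → d ∣ m → d ∣ x → x ≡ y mod m → d ∣ y
  ∣-resp-mod d∣m d∣x x≡y = ∣n∣m%n⇒∣m d∣m (subst (_ ∣_) x≡y (%-presˡ-∣ d∣x d∣m))

  gcd-cong-mod : ∀ {x y} → x ≡ y mod m → gcd x m ≡ gcd y m
  gcd-cong-mod {x} {y} x≡y = ∣-antisym
    (gcd-greatest (∣-resp-mod (gcd[m,n]∣n x m) (gcd[m,n]∣m x m) x≡y) (gcd[m,n]∣n x m))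
    (gcd-greatest (∣-resp-mod (gcd[m,n]∣n y m) (gcd[m,n]∣m y m) (sym x≡y)) (gcd[m,n]∣n y m))

  gcd-neg-mod : ∀ {x y} → x + y ≡ 0 mod m → gcd x m ≡ gcd y m
  gcd-neg-mod {x} {y} x+y≡0 = ∣-antisym (greatest x y x+y≡0) (greatest y x (trans (cong (_% m) (+-comm y x)) x+y≡0))
    where
    greatest : ∀ a b → a + b ≡ 0 mod m → gcd a m ∣ gcd b m
    greatest a b a+b≡0 = gcd-greatest
      (∣m+n∣m⇒∣n (∣-trans (gcd[m,n]∣n a m) (m%n≡0⇒n∣m (a + b) m (trans a+b≡0 (m<n⇒m%n≡m (>-nonZero⁻¹ m)))))
                 (gcd[m,n]∣m a m))
      (gcd[m,n]∣n a m)

  gcd-∣-∣-mod : ∀ {x y s} → y + s ≡ x mod m → gcd ∣ x - y ∣ m ≡ gcd s m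
  gcd-∣-∣-mod {x} {y} {s} y+s≡x with ≤-total y x
  ... | inj₁ y≤x = trans (cong (λ d → gcd d m) (m≤n⇒∣n-m∣≡n∸m y≤x))
                         (gcd-cong-mod (sym (+-cancelˡ-mod y (trans y+s≡x (cong (_% m) (sym (m+[n∸m]≡n y≤x)))))))
  ... | inj₂ x≤y = trans (cong (λ d → gcd d m) (m≤n⇒∣m-n∣≡n∸m x≤y)) (gcd-neg-mod {y ∸ x} {s} (+-cancelˡ-mod x (begin
    (x + (y ∸ x + s)) % m    ≡⟨ cong (_% m) (sym (+-assoc x (y ∸ x) s)) ⟩
    (x + (y ∸ x) + s) % m    ≡⟨ cong (λ t → (t + s) % m) (m+[n∸m]≡n x≤y) ⟩
    (y + s) % m              ≡⟨ y+s≡x ⟩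
    x % m                    ≡⟨ cong (_% m) (+-identityʳ x) ⟨
    (x + 0) % m              ∎)))

  difference-mod : ∀ x y → ∃[ s ] y + s ≡ x mod m
  difference-mod x y = x + y * m ∸ y , trans (cong (_% m) (m+[n∸m]≡n y≤x+y*m)) ([m+kn]%n≡m%n x y m)
    where
    y≤x+y*m : y ≤ x + y * m
    y≤x+y*m = ≤-trans (m≤m*n y m) (m≤n+m (y * m) x)

  cancel-shiftˡ : ∀ x {y y′ s} → x + y ≡ x + y′ + s mod m → y ≡ y′ + s mod m
  cancel-shiftˡ x {y} {y′} {s} eq = +-cancelˡ-mod x (trans eq (cong (_% m) (+-assoc x y′ s)))

  cancel-shiftʳ : ∀ y {x x′ s} → x + y ≡ x′ + y + s mod m → x ≡ x′ + s mod m
  cancel-shiftʳ y {x} {x′} {s} eq = cancel-shiftˡ y (begin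
    (y + x) % m         ≡⟨ cong (_% m) (+-comm y x) ⟩
    (x + y) % m         ≡⟨ eq ⟩
    (x′ + y + s) % m    ≡⟨ cong (λ t → (t + s) % m) (+-comm x′ y) ⟩
    (y + x′ + s) % m    ∎)

  ≡-mod-∣ : ∀ {d x y} .{{_ : NonZero d}} → d ∣ m → x ≡ y mod m → x ≡ y mod d
  ≡-mod-∣ {d} {x} {y} d∣m x≡y = trans (sym (m∣n⇒o%n%m≡o%m d m x d∣m)) (trans (cong (_% d) x≡y) (m∣n⇒o%n%m≡o%m d m y d∣m))

prime∤1 : ∀ {p} → Prime p → p ∤ 1
prime∤1 p-prime p∣1 = nonTrivial⇒≢1 {{prime⇒nonTrivial p-prime}} (∣1⇒≡1 p∣1)

prime∣^⇒∣ : ∀ {p a} → Prime p → ∀ {n} → p ∣ a ^ n → p ∣ a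
prime∣^⇒∣ p-prime {zero}  p∣1 = contradiction p∣1 (prime∤1 p-prime)
prime∣^⇒∣ {a = a} p-prime {suc n} p∣a^1+n with euclidsLemma a (a ^ n) p-prime p∣a^1+n
... | inj₁ p∣a   = p∣a
... | inj₂ p∣a^n = prime∣^⇒∣ p-prime {n} p∣a^n

m∣m^n : ∀ {m n} → 1 ≤ n → m ∣ m ^ n
m∣m^n {m} {suc n} _ = m∣m*n (m ^ n)

pⁿ∣h*g⇒pⁿ∣g : ∀ {p h} → Prime p → p ∤ h → ∀ n {g} → p ^ n ∣ h * g → p ^ n ∣ g
pⁿ∣h*g⇒pⁿ∣g p-prime p∤h zero {g} _ = 1∣ g
pⁿ∣h*g⇒pⁿ∣g {p} {h} p-prime p∤h (suc n) {g} pⁿ⁺¹∣hg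
  with euclidsLemma h g p-prime (∣-trans (m∣m*n (p ^ n)) pⁿ⁺¹∣hg)
... | inj₁ p∣h = contradiction p∣h p∤h
... | inj₂ (divides g′ refl) = subst (p ^ suc n ∣_) (*-comm p g′) (*-monoʳ-∣ p pⁿ∣g′)
  where
  instance
    p≢0 : NonZero p
    p≢0 = prime⇒nonZero p-prime
  pⁿ∣g′ : p ^ n ∣ g′
  pⁿ∣g′ = pⁿ∣h*g⇒pⁿ∣g p-prime p∤h n (*-cancelˡ-∣ p (subst (p * p ^ n ∣_) (h*[g′*p]≡p*[h*g′]) pⁿ⁺¹∣hg))
    where
    h*[g′*p]≡p*[h*g′] : h * (g′ * p) ≡ p * (h * g′)
    h*[g′*p]≡p*[h*g′] = solve 3 (λ h g′ p → h :* (g′ :* p) := p :* (h :* g′)) refl h g′ p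
      where open +-*-Solver

prime∤! : ∀ {p} → Prime p → ∀ {m} → m < p → p ∤ m !
prime∤! p-prime {zero}  _   = prime∤1 p-prime
prime∤! p-prime {suc m} m<p p∣m! with euclidsLemma (suc m) (m !) p-prime p∣m!
... | inj₁ p∣1+m = <⇒≱ m<p (∣⇒≤ p∣1+m)
... | inj₂ p∣m!  = prime∤! p-prime (<-trans (n<1+n m) m<p) p∣m!

prime∣C : ∀ {p k} → Prime p → 0 < k → k < p → p ∣ p C k
prime∣C {p} {k} p-prime 0<k k<p
  with euclidsLemma (p C k) (k ! * (p ∸ k) !) p-prime (subst (p ∣_) (sym C*k!*[p∸k]!≡p!) (n∣n! p {{prime⇒nonZero p-prime}}))
  where
  instance
    k!*[p∸k]!≢0 : NonZero (k ! * (p ∸ k) !)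
    k!*[p∸k]!≢0 = k !* (p ∸ k) !≢0
  C*k!*[p∸k]!≡p! : (p C k) * (k ! * (p ∸ k) !) ≡ p !
  C*k!*[p∸k]!≡p! = trans (cong (_* (k ! * (p ∸ k) !)) (nCk≡n!/k![n-k]! (<⇒≤ k<p))) (m/n*n≡m (k![n∸k]!∣n! (<⇒≤ k<p)))
  n∣n! : ∀ n → .{{NonZero n}} → n ∣ n !
  n∣n! (suc n) = m∣m*n (n !)
... | inj₁ p∣C = p∣C
... | inj₂ p∣k!*[p∸k]! with euclidsLemma (k !) ((p ∸ k) !) p-prime p∣k!*[p∸k]!
...   | inj₁ p∣k!     = contradiction p∣k! (prime∤! p-prime k<p)
...   | inj₂ p∣[p∸k]! = contradiction p∣[p∸k]! (prime∤! p-prime (∸-monoʳ-< 0<k (<⇒≤ k<p)))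

sum-∣ : ∀ {d n} (f : Vector ℕ n) → (∀ i → d ∣ f i) → d ∣ sumⱽ f
sum-∣ {d} {zero}  f d∣f = d ∣0
sum-∣ {d} {suc n} f d∣f = ∣m∣n⇒∣m+n (d∣f zero) (sum-∣ (f ∘ suc) (d∣f ∘ suc))

sum≡ends-mod : ∀ {d} .{{_ : NonZero d}} m (f : Vector ℕ (suc (suc m))) →
               (∀ i → d ∣ f (suc (inject₁ i))) → sumⱽ f ≡ f zero + f (fromℕ (suc m)) mod d
sum≡ends-mod {d} m f d∣middle = begin
  (f zero + sumⱽ (f ∘ suc)) % d                                   ≡⟨ cong (λ s → (f zero + s) % d) (sum-init-last (f ∘ suc)) ⟩
  (f zero + (sumⱽ (f ∘ suc ∘ inject₁) + f (fromℕ (suc m)))) % d   ≡⟨ cong (_% d) (x∙yz≈xz∙y (f zero) _ _) ⟩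
  (f zero + f (fromℕ (suc m)) + sumⱽ (f ∘ suc ∘ inject₁)) % d     ≡⟨ %-remove-+ʳ _ (sum-∣ (f ∘ suc ∘ inject₁) d∣middle) ⟩
  (f zero + f (fromℕ (suc m))) % d                                ∎

-- The group semiring ℕ[ℤ_M]

δ : ℕ → ℕ → ℕ
δ x y = if does (x ≟ y) then 1 else 0

δ-refl : ∀ x → δ x x ≡ 1
δ-refl x = cong (if_then 1 else 0) (dec-true (x ≟ x) refl)

δ-≢ : ∀ {x y} → x ≢ y → δ x y ≡ 0
δ-≢ {x} {y} x≢y = cong (if_then 1 else 0) (dec-false (x ≟ y) x≢y)

infixl 7 _⊗_
_⊗_ : List ℕ → List ℕ → List ℕ
[]       ⊗ ys = []
(x ∷ xs) ⊗ ys = map (x +_) ys ++ xs ⊗ ys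

∑-⊗ : ∀ xs ys f → ∑ (xs ⊗ ys) f ≡ ∑[ x ∈ xs ] ∑[ y ∈ ys ] f (x + y)
∑-⊗ []       ys f = refl
∑-⊗ (x ∷ xs) ys f = begin
  ∑ (map (x +_) ys ++ xs ⊗ ys) f          ≡⟨ ∑-++ (map (x +_) ys) (xs ⊗ ys) f ⟩
  ∑ (map (x +_) ys) f + ∑ (xs ⊗ ys) f     ≡⟨ cong₂ _+_ (∑-map (x +_) ys f) (∑-⊗ xs ys f) ⟩
  ∑[ y ∈ ys ] f (x + y) + ∑[ x ∈ xs ] ∑[ y ∈ ys ] f (x + y) ∎

length-⊗ : ∀ xs ys → length (xs ⊗ ys) ≡ length xs * length ys
length-⊗ []       ys = refl
length-⊗ (x ∷ xs) ys = begin
  length (map (x +_) ys ++ xs ⊗ ys)          ≡⟨ length-++ (map (x +_) ys) ⟩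
  length (map (x +_) ys) + length (xs ⊗ ys)  ≡⟨ cong₂ _+_ (length-map (x +_) ys) (length-⊗ xs ys) ⟩
  length ys + length xs * length ys          ∎

-- A list xs stands for ∑_{x ∈ xs} X^x in ℕ[ℤ_M], exponents read modulo M; count z xs is the
-- coefficient of X^z, and xs ≈ ys is equality in ℕ[ℤ_M].
module GroupSemiring (M : ℕ) .{{_ : NonZero M}} where

  count : ℕ → List ℕ → ℕ
  count z xs = ∑[ x ∈ xs ] δ (x % M) z

  infix 4 _≈_
  _≈_ : List ℕ → List ℕ → Set
  xs ≈ ys = ∀ z → count z xs ≡ count z ys

  Periodic : (ℕ → ℕ) → Set
  Periodic h = ∀ x → h (x % M) ≡ h x

  ∑-fibres : ∀ xs {h} → Periodic h → ∑ xs h ≡ ∑[ z ∈ upTo M ] count z xs * h z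
  ∑-fibres []       h-per = sym (∑-zero (upTo M) (λ _ → refl))
  ∑-fibres (x ∷ xs) {h} h-per = begin
    h x + ∑ xs h                                                 ≡⟨ cong₂ _+_ (trans (sym (h-per x)) (sym at-x)) (∑-fibres xs h-per) ⟩
    ∑[ z ∈ upTo M ] δ (x % M) z * h z + ∑[ z ∈ upTo M ] count z xs * h z   ≡⟨ ∑-distrib-+ (upTo M) _ _ ⟨
    ∑[ z ∈ upTo M ] (δ (x % M) z * h z + count z xs * h z)            ≡⟨ ∑-cong (upTo M) (λ z → *-distribʳ-+ (h z) (δ (x % M) z) _) ⟨
    ∑[ z ∈ upTo M ] count z (x ∷ xs) * h z                            ∎
    where
    at-x : ∑[ z ∈ upTo M ] δ (x % M) z * h z ≡ h (x % M)
    at-x = trans (∑-single _ (upTo⁺ M) (∈-upTo⁺ (m%n<n x M)) (λ _ z≢ → cong (_* _) (δ-≢ (z≢ ∘ sym))))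
                 (trans (cong (_* h (x % M)) (δ-refl (x % M))) (*-identityˡ _))

  ∑-≈ : ∀ xs ys {h} → Periodic h → xs ≈ ys → ∑ xs h ≡ ∑ ys h
  ∑-≈ xs ys {h} h-per xs≈ys = begin
    ∑ xs h                               ≡⟨ ∑-fibres xs h-per ⟩
    ∑[ z ∈ upTo M ] count z xs * h z     ≡⟨ ∑-cong (upTo M) (λ z → cong (_* h z) (xs≈ys z)) ⟩
    ∑[ z ∈ upTo M ] count z ys * h z     ≡⟨ ∑-fibres ys h-per ⟨
    ∑ ys h                               ∎

  length≡∑count : ∀ xs → length xs ≡ ∑[ z ∈ upTo M ] count z xs
  length≡∑count xs = begin
    length xs                    ≡⟨ *-identityʳ (length xs) ⟨
    length xs * 1                ≡⟨ ∑-const xs 1 ⟨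
    ∑[ x ∈ xs ] 1                ≡⟨ ∑-fibres xs (λ _ → refl) ⟩
    ∑[ z ∈ upTo M ] count z xs * 1    ≡⟨ ∑-cong (upTo M) (λ z → *-identityʳ _) ⟩
    ∑[ z ∈ upTo M ] count z xs        ∎

  ≈⇒length≡ : ∀ {xs ys} → xs ≈ ys → length xs ≡ length ys
  ≈⇒length≡ {xs} {ys} xs≈ys =
    trans (length≡∑count xs) (trans (∑-cong (upTo M) xs≈ys) (sym (length≡∑count ys)))

  count-⊗ : ∀ z xs ys → count z (xs ⊗ ys) ≡ ∑[ x ∈ xs ] ∑[ y ∈ ys ] δ ((x + y) % M) z
  count-⊗ z xs ys = ∑-⊗ xs ys (λ s → δ (s % M) z)

  δ+-periodicˡ : ∀ z y → Periodic (λ x → δ ((x + y) % M) z)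
  δ+-periodicˡ z y x = cong (λ s → δ s z) (+-cong-mod (%-≡-mod x) refl)

  δ+-periodicʳ : ∀ z x → Periodic (λ y → δ ((x + y) % M) z)
  δ+-periodicʳ z x y = cong (λ s → δ s z) (+-cong-mod {x = x} refl (%-≡-mod y))

  ⊗-cong : ∀ {xs xs′ ys ys′} → xs ≈ xs′ → ys ≈ ys′ → xs ⊗ ys ≈ xs′ ⊗ ys′
  ⊗-cong {xs} {xs′} {ys} {ys′} xs≈xs′ ys≈ys′ z = begin
    count z (xs ⊗ ys)                                   ≡⟨ count-⊗ z xs ys ⟩
    ∑[ x ∈ xs ] ∑[ y ∈ ys ] δ ((x + y) % M) z           ≡⟨ ∑-cong xs (λ x → ∑-≈ ys ys′ (δ+-periodicʳ z x) ys≈ys′) ⟩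
    ∑[ x ∈ xs ] ∑[ y ∈ ys′ ] δ ((x + y) % M) z          ≡⟨ ∑-≈ xs xs′ (λ x → ∑-cong ys′ (λ y → δ+-periodicˡ z y x)) xs≈xs′ ⟩
    ∑[ x ∈ xs′ ] ∑[ y ∈ ys′ ] δ ((x + y) % M) z         ≡⟨ count-⊗ z xs′ ys′ ⟨
    count z (xs′ ⊗ ys′)                                 ∎

  count-++ : ∀ z xs ys → count z (xs ++ ys) ≡ count z xs + count z ys
  count-++ z xs ys = ∑-++ xs ys (λ x → δ (x % M) z)

  ≈-isEquivalence : IsEquivalence _≈_
  ≈-isEquivalence = record
    { refl  = λ _ → refl
    ; sym   = λ xs≈ys z → sym (xs≈ys z)
    ; trans = λ xs≈ys ys≈zs z → trans (xs≈ys z) (ys≈zs z)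
    }

  ++-cong : ∀ {xs xs′ ys ys′} → xs ≈ xs′ → ys ≈ ys′ → xs ++ ys ≈ xs′ ++ ys′
  ++-cong {xs} {xs′} {ys} {ys′} xs≈xs′ ys≈ys′ z =
    trans (count-++ z xs ys) (trans (cong₂ _+_ (xs≈xs′ z) (ys≈ys′ z)) (sym (count-++ z xs′ ys′)))

  ++-comm : ∀ xs ys → xs ++ ys ≈ ys ++ xs
  ++-comm xs ys z = trans (count-++ z xs ys) (trans (+-comm (count z xs) (count z ys)) (sym (count-++ z ys xs)))

  ⊗-assoc : ∀ xs ys zs → (xs ⊗ ys) ⊗ zs ≈ xs ⊗ (ys ⊗ zs)
  ⊗-assoc xs ys zs z = begin
    count z ((xs ⊗ ys) ⊗ zs)                                          ≡⟨ count-⊗ z (xs ⊗ ys) zs ⟩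
    ∑[ s ∈ xs ⊗ ys ] ∑[ c ∈ zs ] δ ((s + c) % M) z                    ≡⟨ ∑-⊗ xs ys _ ⟩
    ∑[ a ∈ xs ] ∑[ b ∈ ys ] ∑[ c ∈ zs ] δ ((a + b + c) % M) z         ≡⟨ ∑-cong xs (λ a → ∑-cong ys (λ b → ∑-cong zs (λ c →
                                                                          cong (λ s → δ (s % M) z) (+-assoc a b c)))) ⟩
    ∑[ a ∈ xs ] ∑[ b ∈ ys ] ∑[ c ∈ zs ] δ ((a + (b + c)) % M) z       ≡⟨ ∑-cong xs (λ a → ∑-⊗ ys zs (λ t → δ ((a + t) % M) z)) ⟨
    ∑[ a ∈ xs ] ∑[ t ∈ ys ⊗ zs ] δ ((a + t) % M) z                    ≡⟨ count-⊗ z xs (ys ⊗ zs) ⟨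
    count z (xs ⊗ (ys ⊗ zs))                                          ∎

  ⊗-comm : ∀ xs ys → xs ⊗ ys ≈ ys ⊗ xs
  ⊗-comm xs ys z = begin
    count z (xs ⊗ ys)                               ≡⟨ count-⊗ z xs ys ⟩
    ∑[ x ∈ xs ] ∑[ y ∈ ys ] δ ((x + y) % M) z       ≡⟨ ∑-comm xs ys _ ⟩
    ∑[ y ∈ ys ] ∑[ x ∈ xs ] δ ((x + y) % M) z       ≡⟨ ∑-cong ys (λ y → ∑-cong xs (λ x → cong (λ s → δ (s % M) z) (+-comm x y))) ⟩
    ∑[ y ∈ ys ] ∑[ x ∈ xs ] δ ((y + x) % M) z       ≡⟨ count-⊗ z ys xs ⟨
    count z (ys ⊗ xs)                               ∎

  ⊗-identityˡ : ∀ xs → (0 ∷ []) ⊗ xs ≈ xs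
  ⊗-identityˡ xs z = trans (count-⊗ z (0 ∷ []) xs) (+-identityʳ _)

  ⊗-identityʳ : ∀ xs → xs ⊗ (0 ∷ []) ≈ xs
  ⊗-identityʳ xs z = trans (⊗-comm xs (0 ∷ []) z) (⊗-identityˡ xs z)

  ⊗-zeroʳ : ∀ xs → xs ⊗ [] ≈ []
  ⊗-zeroʳ xs z = trans (⊗-comm xs [] z) refl

  ⊗-distribˡ-++ : ∀ xs ys zs → xs ⊗ (ys ++ zs) ≈ xs ⊗ ys ++ xs ⊗ zs
  ⊗-distribˡ-++ xs ys zs z = begin
    count z (xs ⊗ (ys ++ zs))                                        ≡⟨ count-⊗ z xs (ys ++ zs) ⟩
    ∑[ x ∈ xs ] ∑[ y ∈ ys ++ zs ] δ ((x + y) % M) z                  ≡⟨ ∑-cong xs (λ x → ∑-++ ys zs _) ⟩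
    ∑[ x ∈ xs ] (∑[ y ∈ ys ] δ ((x + y) % M) z + ∑[ y ∈ zs ] δ ((x + y) % M) z)  ≡⟨ ∑-distrib-+ xs _ _ ⟩
    ∑[ x ∈ xs ] ∑[ y ∈ ys ] δ ((x + y) % M) z + ∑[ x ∈ xs ] ∑[ y ∈ zs ] δ ((x + y) % M) z
                                                                     ≡⟨ cong₂ _+_ (count-⊗ z xs ys) (count-⊗ z xs zs) ⟨
    count z (xs ⊗ ys) + count z (xs ⊗ zs)                            ≡⟨ count-++ z (xs ⊗ ys) (xs ⊗ zs) ⟨
    count z (xs ⊗ ys ++ xs ⊗ zs)                                     ∎

  ⊗-distribʳ-++ : ∀ zs xs ys → (xs ++ ys) ⊗ zs ≈ xs ⊗ zs ++ ys ⊗ zs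
  ⊗-distribʳ-++ zs xs ys z = begin
    count z ((xs ++ ys) ⊗ zs)                ≡⟨ ⊗-comm (xs ++ ys) zs z ⟩
    count z (zs ⊗ (xs ++ ys))                ≡⟨ ⊗-distribˡ-++ zs xs ys z ⟩
    count z (zs ⊗ xs ++ zs ⊗ ys)             ≡⟨ ++-cong {zs ⊗ xs} {xs ⊗ zs} {zs ⊗ ys} {ys ⊗ zs} (⊗-comm zs xs) (⊗-comm zs ys) z ⟩
    count z (xs ⊗ zs ++ ys ⊗ zs)             ∎

  isCommutativeSemiring : IsCommutativeSemiring _≈_ _++_ _⊗_ [] (0 ∷ [])
  isCommutativeSemiring = record
    { isSemiring = record
      { isSemiringWithoutAnnihilatingZero = record
        { +-isCommutativeMonoid = record
          { isMonoid = record
            { isSemigroup = record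
              { isMagma = record { isEquivalence = ≈-isEquivalence ; ∙-cong = λ {xs} {xs′} {ys} {ys′} → ++-cong {xs} {xs′} {ys} {ys′} }
              ; assoc   = λ xs ys zs z → cong (count z) (++-assoc xs ys zs)
              }
            ; identity = (λ _ _ → refl) , (λ xs z → cong (count z) (++-identityʳ xs))
            }
          ; comm = ++-comm
          }
        ; *-cong     = λ {xs} {xs′} {ys} {ys′} → ⊗-cong {xs} {xs′} {ys} {ys′}
        ; *-assoc    = ⊗-assoc
        ; *-identity = ⊗-identityˡ , ⊗-identityʳ
        ; distrib    = ⊗-distribˡ-++ , ⊗-distribʳ-++
        }
      ; zero = (λ _ _ → refl) , ⊗-zeroʳ
      }
    ; *-comm = ⊗-comm
    }

  groupSemiring : CommutativeSemiring 0ℓ 0ℓ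
  groupSemiring = record { isCommutativeSemiring = isCommutativeSemiring }

  open import Algebra.Properties.Semiring.Exp (CommutativeSemiring.semiring groupSemiring) public
    using () renaming (_^_ to _^ᴳ_)
  open import Algebra.Properties.Semiring.Mult (CommutativeSemiring.semiring groupSemiring)
    using () renaming (_×_ to _×ᴳ_)
  open import Algebra.Properties.Semiring.Sum (CommutativeSemiring.semiring groupSemiring)
    using () renaming (sum to sumᴳ)
  import Algebra.Properties.CommutativeSemiring.Binomial groupSemiring as Binomial

  count-× : ∀ z n xs → count z (n ×ᴳ xs) ≡ n * count z xs
  count-× z zero    xs = refl
  count-× z (suc n) xs = trans (count-++ z xs (n ×ᴳ xs)) (cong (count z xs +_) (count-× z n xs))

  count-sum : ∀ z {n} (v : Vector (List ℕ) n) → count z (sumᴳ v) ≡ sumⱽ (λ i → count z (v i))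
  count-sum z {zero}  v = refl
  count-sum z {suc n} v = trans (count-++ z (v zero) _) (cong (count z (v zero) +_) (count-sum z (v ∘ suc)))

  singleton-^ : ∀ c n → (c ∷ []) ^ᴳ n ≈ n * c ∷ []
  singleton-^ c zero    = λ _ → refl
  singleton-^ c (suc n) = ⊗-cong {c ∷ []} {c ∷ []} {(c ∷ []) ^ᴳ n} {n * c ∷ []} (λ _ → refl) (singleton-^ c n)

  length-^ : ∀ xs n → length (xs ^ᴳ n) ≡ length xs ^ n
  length-^ xs zero    = refl
  length-^ xs (suc n) = trans (length-⊗ xs (xs ^ᴳ n)) (cong (length xs *_) (length-^ xs n))

  frobenius : ∀ {p} .{{_ : NonZero p}} → Prime p → ∀ xs z → count z (xs ^ᴳ p) ≡ count z (map (p *_) xs) mod p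
  frobenius {suc m} p-prime []       z = refl
  frobenius {suc m} p-prime (c ∷ xs) z = begin
    count z ((c ∷ xs) ^ᴳ p) % p                          ≡⟨ cong (_% p) (Binomial.theorem p (c ∷ []) xs z) ⟩
    count z (Binomial.binomialExpansion (c ∷ []) xs p) % p ≡⟨ cong (_% p) (count-sum z (Binomial.binomialTerm (c ∷ []) xs p)) ⟩
    sumⱽ term % p                                        ≡⟨ sum≡ends-mod m term middle ⟩
    (term zero + term (fromℕ p)) % p                      ≡⟨ cong₂ (λ a b → (a + b) % p) first last ⟩
    (count z (xs ^ᴳ p) + count z (p * c ∷ [])) % p       ≡⟨ +-cong-mod {x = count z (xs ^ᴳ p)} {x′ = count z (map (p *_) xs)} {y = count z (p * c ∷ [])} (frobenius p-prime xs z) refl ⟩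
    (count z (map (p *_) xs) + count z (p * c ∷ [])) % p ≡⟨ cong (_% p) (+-comm (count z (map (p *_) xs)) _) ⟩
    (count z (p * c ∷ []) + count z (map (p *_) xs)) % p ≡⟨ cong (λ a → (a + count z (map (p *_) xs)) % p) (+-identityʳ (δ ((p * c) % M) z)) ⟩
    count z (map (p *_) (c ∷ xs)) % p                    ∎
    where
    p : ℕ
    p = suc m
    term : Vector ℕ (suc p)
    term k = count z (Binomial.binomialTerm (c ∷ []) xs p k)
    term≡ : ∀ k → term k ≡ (p C toℕ k) * count z ((c ∷ []) ^ᴳ toℕ k ⊗ xs ^ᴳ (p ∸ toℕ k))
    term≡ k = count-× z (p C toℕ k) _
    middle : ∀ (i : Fin m) → p ∣ term (suc (inject₁ i))
    middle i = subst (p ∣_) (sym (term≡ (suc (inject₁ i))))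
      (∣m⇒∣m*n _ (prime∣C p-prime z<s (s<s (subst (_< m) (sym (toℕ-inject₁ i)) (toℕ<n i)))))
    first : term zero ≡ count z (xs ^ᴳ p)
    first = trans (term≡ zero) (trans (*-identityˡ _) (⊗-identityˡ (xs ^ᴳ p) z))
    last : term (fromℕ p) ≡ count z (p * c ∷ [])
    last = begin
      term (fromℕ p)                                                  ≡⟨ term≡ (fromℕ p) ⟩
      (p C toℕ (fromℕ p)) * count z ((c ∷ []) ^ᴳ toℕ (fromℕ p) ⊗ xs ^ᴳ (p ∸ toℕ (fromℕ p)))
                                                                      ≡⟨ cong (λ k → (p C k) * count z ((c ∷ []) ^ᴳ k ⊗ xs ^ᴳ (p ∸ k))) (toℕ-fromℕ p) ⟩
      (p C p) * count z ((c ∷ []) ^ᴳ p ⊗ xs ^ᴳ (p ∸ p))               ≡⟨ cong₂ (λ C k → C * count z ((c ∷ []) ^ᴳ p ⊗ xs ^ᴳ k)) (nCn≡1 p) (n∸n≡0 p) ⟩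
      1 * count z ((c ∷ []) ^ᴳ p ⊗ (0 ∷ []))                          ≡⟨ *-identityˡ _ ⟩
      count z ((c ∷ []) ^ᴳ p ⊗ (0 ∷ []))                              ≡⟨ ⊗-identityʳ ((c ∷ []) ^ᴳ p) z ⟩
      count z ((c ∷ []) ^ᴳ p)                                         ≡⟨ singleton-^ c p z ⟩
      count z (p * c ∷ [])                                            ∎

  count-upTo : ∀ {z} → z < M → count z (upTo M) ≡ 1
  count-upTo {z} z<M = begin
    ∑[ y ∈ upTo M ] δ (y % M) z   ≡⟨ ∑-single _ (upTo⁺ M) (∈-upTo⁺ z<M) vanish ⟩
    δ (z % M) z                   ≡⟨ cong (λ r → δ r z) (m<n⇒m%n≡m z<M) ⟩
    δ z z                         ≡⟨ δ-refl z ⟩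
    1                             ∎
    where
    vanish : ∀ {y} → y ∈ upTo M → y ≢ z → δ (y % M) z ≡ 0
    vanish y∈ y≢z = δ-≢ (y≢z ∘ trans (sym (m<n⇒m%n≡m (∈-upTo⁻ y∈))))

  count-≥ : ∀ {z} xs → M ≤ z → count z xs ≡ 0
  count-≥ xs M≤z = ∑-zero xs (λ {x} _ → δ-≢ (λ x%M≡z → <⇒≱ (m%n<n x M) (subst (M ≤_) (sym x%M≡z) M≤z)))

  count≡1⇒≈upTo : ∀ {xs} → (∀ {z} → z < M → count z xs ≡ 1) → xs ≈ upTo M
  count≡1⇒≈upTo {xs} count≡1 z with z <? M
  ... | yes z<M = trans (count≡1 z<M) (sym (count-upTo z<M))
  ... | no  z≮M = trans (count-≥ xs (≮⇒≥ z≮M)) (sym (count-≥ (upTo M) (≮⇒≥ z≮M)))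

  count-translate : ∀ z a → count z (map (a +_) (upTo M)) ≡ count z (upTo M)
  count-translate z zero    = ∑-map (0 +_) (upTo M) _
  count-translate z (suc a) = begin
    count z (map (suc a +_) (upTo M))           ≡⟨ ∑-map (suc a +_) (upTo M) _ ⟩
    ∑[ y ∈ upTo M ] δ ((suc a + y) % M) z       ≡⟨ ∑-cong (upTo M) (λ y → cong (λ s → δ (s % M) z) (sym (+-suc a y))) ⟩
    ∑[ y ∈ upTo M ] δ ((a + suc y) % M) z       ≡⟨ ∑-rotate M (λ y → δ ((a + y) % M) z) wrap ⟩
    ∑[ y ∈ upTo M ] δ ((a + y) % M) z           ≡⟨ ∑-map (a +_) (upTo M) _ ⟨
    count z (map (a +_) (upTo M))               ≡⟨ count-translate z a ⟩
    count z (upTo M)                            ∎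
    where
    wrap : δ ((a + M) % M) z ≡ δ ((a + 0) % M) z
    wrap = cong (λ s → δ s z) (trans ([m+n]%n≡m%n a M) (cong (_% M) (sym (+-identityʳ a))))

  count-⊗-upTo : ∀ z xs → count z (xs ⊗ upTo M) ≡ length xs * count z (upTo M)
  count-⊗-upTo z xs = begin
    count z (xs ⊗ upTo M)                                  ≡⟨ count-⊗ z xs (upTo M) ⟩
    ∑[ x ∈ xs ] ∑[ y ∈ upTo M ] δ ((x + y) % M) z          ≡⟨ ∑-cong xs (λ x → ∑-map (x +_) (upTo M) _) ⟨
    ∑[ x ∈ xs ] count z (map (x +_) (upTo M))              ≡⟨ ∑-cong xs (λ x → count-translate z x) ⟩
    ∑[ x ∈ xs ] count z (upTo M)                           ≡⟨ ∑-const xs (count z (upTo M)) ⟩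
    length xs * count z (upTo M)                           ∎

  -- A ⊕ B = ℤ_M is the identity A(X) · B(X) = 1 + X + ⋯ + X^(M-1).
  Tiles : List ℕ → List ℕ → Set
  Tiles xs ys = xs ⊗ ys ≈ upTo M

  tiles⇒length*length≡M : ∀ xs ys → Tiles xs ys → length xs * length ys ≡ M
  tiles⇒length*length≡M xs ys tiles =
    trans (sym (length-⊗ xs ys)) (trans (≈⇒length≡ {xs ⊗ ys} {upTo M} tiles) (length-upTo M))

  tiles⇒sums-distinct : ∀ {xs ys x x′ y y′} → Tiles xs ys → x ∈ xs → x′ ∈ xs → x ≢ x′ → y ∈ ys → y′ ∈ ys →
                        x + y ≡ x′ + y′ mod M → ⊥
  tiles⇒sums-distinct {xs} {ys} {x} {x′} {y} {y′} tiles x∈ x′∈ x≢x′ y∈ y′∈ sums≡ = 1+n≰n 2≤1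
    where
    z : ℕ
    z = (x + y) % M
    H : ℕ → ℕ
    H a = ∑[ b ∈ ys ] δ ((a + b) % M) z
    hits : ∀ {a b} → a ∈ xs → b ∈ ys → (a + b) % M ≡ z → 1 ≤ H a
    hits {a} {b} _ b∈ ab≡z = subst (_≤ H a) (trans (cong (λ s → δ s z) ab≡z) (δ-refl z)) (∈⇒≤∑ (λ b → δ ((a + b) % M) z) b∈)
    ∑H≡1 : ∑ xs H ≡ 1
    ∑H≡1 = trans (sym (count-⊗ z xs ys)) (trans (tiles z) (count-upTo (m%n<n (x + y) M)))
    2≤1 : 2 ≤ 1
    2≤1 = ≤-trans (+-mono-≤ (hits x∈ y∈ refl) (hits x′∈ y′∈ (sym sums≡))) (≤-trans (∈₂⇒≤∑ H x∈ x′∈ x≢x′) (≤-reflexive ∑H≡1))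

  -- Tijdeman's dilation theorem

  frobenius-⊗ : ∀ {p} .{{_ : NonZero p}} → Prime p → ∀ xs ys z →
                count z (map (p *_) xs ⊗ ys) ≡ count z (xs ^ᴳ p ⊗ ys) mod p
  frobenius-⊗ {p} p-prime xs ys z = begin
    count z (map (p *_) xs ⊗ ys) % p                      ≡⟨ cong (_% p) (count-⊗-fibres (map (p *_) xs)) ⟩
    (∑[ w ∈ upTo M ] count w (map (p *_) xs) * H w) % p   ≡⟨ ∑-cong-mod (upTo M) (λ w → *-congʳ-mod (H w)
                                                               {x = count w (map (p *_) xs)} {y = count w (xs ^ᴳ p)} (sym (frobenius p-prime xs w))) ⟩
    (∑[ w ∈ upTo M ] count w (xs ^ᴳ p) * H w) % p         ≡⟨ cong (_% p) (count-⊗-fibres (xs ^ᴳ p)) ⟨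
    count z (xs ^ᴳ p ⊗ ys) % p                            ∎
    where
    H : ℕ → ℕ
    H x = ∑[ y ∈ ys ] δ ((x + y) % M) z
    count-⊗-fibres : ∀ as → count z (as ⊗ ys) ≡ ∑[ w ∈ upTo M ] count w as * H w
    count-⊗-fibres as = trans (count-⊗ z as ys) (∑-fibres as (λ x → ∑-cong ys (λ y → δ+-periodicˡ z y x)))

  tiles⇒count-^-⊗ : ∀ xs ys → Tiles xs ys → ∀ m z → count z (xs ^ᴳ suc m ⊗ ys) ≡ length xs ^ m * count z (upTo M)
  tiles⇒count-^-⊗ xs ys tiles m z = begin
    count z ((xs ⊗ xs ^ᴳ m) ⊗ ys)         ≡⟨ ⊗-cong {xs ⊗ xs ^ᴳ m} {xs ^ᴳ m ⊗ xs} {ys} {ys} (⊗-comm xs (xs ^ᴳ m)) (λ _ → refl) z ⟩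
    count z ((xs ^ᴳ m ⊗ xs) ⊗ ys)         ≡⟨ ⊗-assoc (xs ^ᴳ m) xs ys z ⟩
    count z (xs ^ᴳ m ⊗ (xs ⊗ ys))         ≡⟨ ⊗-cong {xs ^ᴳ m} {xs ^ᴳ m} {xs ⊗ ys} {upTo M} (λ _ → refl) tiles z ⟩
    count z (xs ^ᴳ m ⊗ upTo M)            ≡⟨ count-⊗-upTo z (xs ^ᴳ m) ⟩
    length (xs ^ᴳ m) * count z (upTo M)   ≡⟨ cong (_* count z (upTo M)) (length-^ xs m) ⟩
    length xs ^ m * count z (upTo M)      ∎

  -- The coefficients of pA ⊗ B are ≡ |A|^(p-1) ≢ 0 (mod p) by Frobenius and add up to |A| |B| = M,
  -- so they all equal 1.
  dilate-prime : ∀ {p} .{{_ : NonZero p}} → Prime p → ∀ xs ys → p ∤ length xs → Tiles xs ys →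
                 Tiles (map (p *_) xs) ys
  dilate-prime {suc m} p-prime xs ys p∤∣xs∣ tiles = count≡1⇒≈upTo {map (p *_) xs ⊗ ys} c≡1
    where
    p : ℕ
    p = suc m
    c : ℕ → ℕ
    c z = count z (map (p *_) xs ⊗ ys)
    c≢0 : ∀ {z} → z < M → c z ≢ 0
    c≢0 {z} z<M cz≡0 = p∤∣xs∣ (prime∣^⇒∣ p-prime {m} (m%n≡0⇒n∣m _ p (begin
      length xs ^ m % p                          ≡⟨ cong (_% p) (*-identityʳ (length xs ^ m)) ⟨
      (length xs ^ m * 1) % p                    ≡⟨ cong (λ k → (length xs ^ m * k) % p) (count-upTo z<M) ⟨
      (length xs ^ m * count z (upTo M)) % p     ≡⟨ cong (_% p) (tiles⇒count-^-⊗ xs ys tiles m z) ⟨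
      count z (xs ^ᴳ p ⊗ ys) % p                 ≡⟨ frobenius-⊗ p-prime xs ys z ⟨
      c z % p                                    ≡⟨ cong (_% p) cz≡0 ⟩
      0                                          ∎)))
    ∑c≡M : ∑[ z ∈ upTo M ] c z ≡ length (upTo M)
    ∑c≡M = begin
      ∑[ z ∈ upTo M ] c z                        ≡⟨ length≡∑count (map (p *_) xs ⊗ ys) ⟨
      length (map (p *_) xs ⊗ ys)                ≡⟨ length-⊗ (map (p *_) xs) ys ⟩
      length (map (p *_) xs) * length ys         ≡⟨ cong (_* length ys) (length-map (p *_) xs) ⟩
      length xs * length ys                      ≡⟨ tiles⇒length*length≡M xs ys tiles ⟩
      M                                          ≡⟨ length-upTo M ⟨
      length (upTo M)                            ∎
    c≡1 : ∀ {z} → z < M → c z ≡ 1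
    c≡1 z<M = ∑≡length⇒≡1 (upTo M) c (c≢0 ∘ ∈-upTo⁻) ∑c≡M (∈-upTo⁺ z<M)

  dilate-product : ∀ {ps} → All Prime ps → ∀ xs ys → (∀ {ℓ} → ℓ ∈ ps → ℓ ∤ length xs) → Tiles xs ys →
                   Tiles (map (product ps *_) xs) ys
  dilate-product [] xs ys _ tiles = subst (λ as → Tiles as ys) (sym map-1*) tiles
    where
    map-1* : map (1 *_) xs ≡ xs
    map-1* = trans (map-cong *-identityˡ xs) (map-id xs)
  dilate-product {ℓ ∷ ps} (ℓ-prime ∷ ps-prime) xs ys ∤∣xs∣ tiles =
    subst (λ as → Tiles as ys) map-*-assoc
      (dilate-prime {{prime⇒nonZero ℓ-prime}} ℓ-prime (map (product ps *_) xs) ys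
                    (∤∣xs∣ (here refl) ∘ subst (ℓ ∣_) (length-map _ xs))
                    (dilate-product ps-prime xs ys (∤∣xs∣ ∘ there) tiles))
    where
    map-*-assoc : map (ℓ *_) (map (product ps *_) xs) ≡ map (ℓ * product ps *_) xs
    map-*-assoc = trans (sym (map-∘ xs)) (map-cong (λ a → sym (*-assoc ℓ (product ps) a)) xs)

  dilate : ∀ {w} .{{_ : NonZero w}} xs ys → (∀ {ℓ} → Prime ℓ → ℓ ∣ w → ℓ ∤ length xs) → Tiles xs ys →
           Tiles (map (w *_) xs) ys
  dilate {w} xs ys w⊥∣xs∣ tiles =
    subst (λ v → Tiles (map (v *_) xs) ys) (sym (isFactorisation f))
      (dilate-product (factorsPrime f) xs ys (λ ℓ∈ → w⊥∣xs∣ (All.lookup (factorsPrime f) ℓ∈)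
                                                    (subst (_ ∣_) (sym (isFactorisation f)) (∈⇒∣product ℓ∈))) tiles)
    where
    f : PrimeFactorisation w
    f = factorise w

NoCommonPrimeFactor : ℕ → ℕ → Set
NoCommonPrimeFactor m n = ∀ {ℓ} → Prime ℓ → ℓ ∣ m → ℓ ∤ n

GCD≡1⇒noCommonPrimeFactor : ∀ {m n} → GCD m n 1 → NoCommonPrimeFactor m n
GCD≡1⇒noCommonPrimeFactor gcd≡1 ℓ-prime ℓ∣m ℓ∣n = prime∤1 ℓ-prime (GCD.greatest gcd≡1 (ℓ∣m , ℓ∣n))

noCommonPrimeFactor-* : ∀ {a b n} → NoCommonPrimeFactor a n → NoCommonPrimeFactor b n → NoCommonPrimeFactor (a * b) n
noCommonPrimeFactor-* {a} {b} a⊥n b⊥n ℓ-prime ℓ∣ab with euclidsLemma a b ℓ-prime ℓ∣ab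
... | inj₁ ℓ∣a = a⊥n ℓ-prime ℓ∣a
... | inj₂ ℓ∣b = b⊥n ℓ-prime ℓ∣b

coprimePart : (m w₀ : ℕ) .{{_ : NonZero m}} → ℕ
coprimePart m w₀ = product (filter (λ ℓ → ¬? (ℓ ∣? w₀)) (factors (factorise m)))

module _ (m w₀ : ℕ) .{{_ : NonZero m}} where

  private
    ∤w₀? : ∀ ℓ → Dec (ℓ ∤ w₀)
    ∤w₀? ℓ = ¬? (ℓ ∣? w₀)
    coprimeFactors : List ℕ
    coprimeFactors = filter ∤w₀? (factors (factorise m))
    coprimeFactors-prime : All Prime coprimeFactors
    coprimeFactors-prime = All.filter⁺ ∤w₀? (factorsPrime (factorise m))

  coprimePart≢0 : NonZero (coprimePart m w₀)
  coprimePart≢0 = productOfPrimes≢0 coprimeFactors-prime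

  coprimePart-∤ : ∀ {ℓ} → Prime ℓ → ℓ ∣ coprimePart m w₀ → ℓ ∤ w₀
  coprimePart-∤ ℓ-prime ℓ∣part =
    proj₂ (∈-filter⁻ ∤w₀? {xs = factors (factorise m)} (factorisationHasAllPrimeFactors ℓ-prime ℓ∣part coprimeFactors-prime))

  coprimePart-∣ : ∀ {ℓ} → Prime ℓ → ℓ ∣ m → ℓ ∤ w₀ → ℓ ∣ coprimePart m w₀
  coprimePart-∣ {ℓ} ℓ-prime ℓ∣m ℓ∤w₀ = ∈⇒∣product (∈-filter⁺ ∤w₀? ℓ∈factors ℓ∤w₀)
    where
    f : PrimeFactorisation m
    f = factorise m
    ℓ∈factors : ℓ ∈ factors f
    ℓ∈factors = factorisationHasAllPrimeFactors ℓ-prime (subst (_ ∣_) (isFactorisation f) ℓ∣m) (factorsPrime f)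

  coprime-lift : ∀ {m′} → NoCommonPrimeFactor w₀ m′ → NoCommonPrimeFactor (w₀ + m′ * coprimePart m w₀) m
  coprime-lift {m′} w₀⊥m′ {ℓ} ℓ-prime ℓ∣w ℓ∣m with ℓ ∣? w₀
  ... | yes ℓ∣w₀ with euclidsLemma m′ (coprimePart m w₀) ℓ-prime (∣m+n∣m⇒∣n ℓ∣w ℓ∣w₀)
  ...   | inj₁ ℓ∣m′    = w₀⊥m′ ℓ-prime ℓ∣w₀ ℓ∣m′
  ...   | inj₂ ℓ∣part  = coprimePart-∤ ℓ-prime ℓ∣part ℓ∣w₀
  coprime-lift {m′} w₀⊥m′ {ℓ} ℓ-prime ℓ∣w ℓ∣m | no ℓ∤w₀ =
    ℓ∤w₀ (∣m+n∣m⇒∣n (subst (ℓ ∣_) (+-comm w₀ _) ℓ∣w) (∣n⇒∣m*n m′ (coprimePart-∣ ℓ-prime ℓ∣m ℓ∤w₀)))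

-- Bézout over ℕ gives x u′ ≡ ±1 (mod M′) for u′ = u/g, M′ = M/g, g = gcd(u, M); the multiplier
-- x v′ is a unit mod M′, and coprime-lift turns it into a unit mod M.
module UnitMultiplier (M u v : ℕ) .{{_ : NonZero M}} (gcd≡ : gcd u M ≡ gcd v M) where

  private
    g : ℕ
    g = gcd u M
    instance
      g≢0 : NonZero g
      g≢0 = ≢-nonZero (gcd[m,n]≢0 u M (inj₂ (≢-nonZero⁻¹ M)))
    u′ v′ M′ : ℕ
    u′ = u / g
    v′ = v / g
    M′ = M / g
    g∣v : g ∣ v
    g∣v = subst (_∣ v) (sym gcd≡) (gcd[m,n]∣m v M)
    u≡ : u ≡ u′ * g
    u≡ = sym (m/n*n≡m (gcd[m,n]∣m u M))
    v≡ : v ≡ v′ * g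
    v≡ = sym (m/n*n≡m g∣v)
    M≡ : M ≡ M′ * g
    M≡ = sym (m/n*n≡m (gcd[m,n]∣n u M))
    u′⊥M′ : GCD u′ M′ 1
    u′⊥M′ = GCD-/gcd u M
    v′⊥M′ : NoCommonPrimeFactor v′ M′
    v′⊥M′ = GCD≡1⇒noCommonPrimeFactor (subst (GCD v′ M′) (n/n≡1 g)
              (GCD-/ g∣v (gcd[m,n]∣n u M) ∣-refl (subst (GCD v M) (sym gcd≡) (gcd-GCD v M))))

    multiplier : ℕ → ℕ
    multiplier x = x * v′ + M′ * coprimePart M (x * v′)

    multiplier*u : ∀ x → multiplier x * u ≡ x * u′ * v + coprimePart M (x * v′) * u′ * M
    multiplier*u x = begin
      (x * v′ + M′ * k) * u                     ≡⟨ cong ((x * v′ + M′ * k) *_) u≡ ⟩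
      (x * v′ + M′ * k) * (u′ * g)              ≡⟨ solve 6 (λ x v′ M′ k u′ g → (x :* v′ :+ M′ :* k) :* (u′ :* g)
                                                              := x :* u′ :* (v′ :* g) :+ k :* u′ :* (M′ :* g)) refl x v′ M′ k u′ g ⟩
      x * u′ * (v′ * g) + k * u′ * (M′ * g)     ≡⟨ cong₂ (λ a b → x * u′ * a + k * u′ * b) v≡ M≡ ⟨
      x * u′ * v + k * u′ * M                   ∎
      where
      open +-*-Solver
      k : ℕ
      k = coprimePart M (x * v′)

    *M′*v≡*v′*M : ∀ y → y * M′ * v ≡ y * v′ * M
    *M′*v≡*v′*M y = begin
      y * M′ * v             ≡⟨ cong (y * M′ *_) v≡ ⟩
      y * M′ * (v′ * g)      ≡⟨ solve 4 (λ y M′ v′ g → y :* M′ :* (v′ :* g) := y :* v′ :* (M′ :* g)) refl y M′ v′ g ⟩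
      y * v′ * (M′ * g)      ≡⟨ cong (y * v′ *_) M≡ ⟨
      y * v′ * M             ∎
      where open +-*-Solver

    ∣1+a∧∣a⇒∣1 : ∀ {ℓ a} → ℓ ∣ 1 + a → ℓ ∣ a → ℓ ∣ 1
    ∣1+a∧∣a⇒∣1 {ℓ} {a} ℓ∣1+a ℓ∣a = ∣m+n∣m⇒∣n (subst (ℓ ∣_) (+-comm 1 a) ℓ∣1+a) ℓ∣a

    multiplier≢0 : ∀ x → NonZero (multiplier x)
    multiplier≢0 x = >-nonZero (<-≤-trans (>-nonZero⁻¹ (M′ * k) {{M′*k≢0}}) (m≤n+m (M′ * k) (x * v′)))
      where
      k : ℕ
      k = coprimePart M (x * v′)
      M′*k≢0 : NonZero (M′ * k)
      M′*k≢0 = m*n≢0 M′ k {{≢-nonZero (n/gcd[m,n]≢0 u M)}} {{coprimePart≢0 M (x * v′)}}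

    multiplier-coprime : ∀ x → NoCommonPrimeFactor x M′ → NoCommonPrimeFactor (multiplier x) M
    multiplier-coprime x x⊥M′ = coprime-lift M (x * v′) (noCommonPrimeFactor-* x⊥M′ v′⊥M′)

  unit-multiplier : ∃[ w ] NonZero w × NoCommonPrimeFactor w M × (w * u ≡ v mod M ⊎ w * u + v ≡ 0 mod M)
  unit-multiplier with Bézout.identity u′⊥M′
  ... | Bézout.+- x y 1+yM′≡xu′ = multiplier x , multiplier≢0 x , multiplier-coprime x x⊥M′ , inj₁ (begin
    (multiplier x * u) % M                      ≡⟨ cong (_% M) (multiplier*u x) ⟩
    (x * u′ * v + K * M) % M                    ≡⟨ [m+kn]%n≡m%n _ K M ⟩
    (x * u′ * v) % M                            ≡⟨ cong (λ t → (t * v) % M) 1+yM′≡xu′ ⟨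
    ((1 + y * M′) * v) % M                      ≡⟨ cong (λ t → (v + t) % M) (*M′*v≡*v′*M y) ⟩
    (v + y * v′ * M) % M                        ≡⟨ [m+kn]%n≡m%n v (y * v′) M ⟩
    v % M                                       ∎)
    where
    K : ℕ
    K = coprimePart M (x * v′) * u′
    x⊥M′ : NoCommonPrimeFactor x M′
    x⊥M′ {ℓ} ℓ-prime ℓ∣x ℓ∣M′ =
      prime∤1 ℓ-prime (∣1+a∧∣a⇒∣1 (subst (ℓ ∣_) (sym 1+yM′≡xu′) (∣m⇒∣m*n u′ ℓ∣x)) (∣n⇒∣m*n y ℓ∣M′))
  ... | Bézout.-+ x y 1+xu′≡yM′ = multiplier x , multiplier≢0 x , multiplier-coprime x x⊥M′ , inj₂ (begin
    (multiplier x * u + v) % M                  ≡⟨ cong (λ t → (t + v) % M) (multiplier*u x) ⟩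
    (x * u′ * v + K * M + v) % M                ≡⟨ cong (_% M) (xy∙z≈zx∙y (x * u′ * v) (K * M) v) ⟩
    (v + x * u′ * v + K * M) % M                ≡⟨ [m+kn]%n≡m%n _ K M ⟩
    ((1 + x * u′) * v) % M                      ≡⟨ cong (λ t → (t * v) % M) 1+xu′≡yM′ ⟩
    (y * M′ * v) % M                            ≡⟨ cong (_% M) (*M′*v≡*v′*M y) ⟩
    (y * v′ * M) % M                            ≡⟨ m*n%n≡0 (y * v′) M ⟩
    0                                           ≡⟨ m<n⇒m%n≡m (>-nonZero⁻¹ M) ⟨
    0 % M                                       ∎)
    where
    K : ℕ
    K = coprimePart M (x * v′) * u′
    x⊥M′ : NoCommonPrimeFactor x M′
    x⊥M′ {ℓ} ℓ-prime ℓ∣x ℓ∣M′ =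
      prime∤1 ℓ-prime (∣1+a∧∣a⇒∣1 (subst (ℓ ∣_) (sym 1+xu′≡yM′) (∣n⇒∣m*n y ℓ∣M′)) (∣m⇒∣m*n u′ ℓ∣x))

-- Sands' theorem

module Sands (M : ℕ) .{{_ : NonZero M}} where

  open GroupSemiring M

  private
    gcd≡ : ℕ → ℕ → Set
    gcd≡ s t = gcd s M ≡ gcd t M

    -- With u = a − a′ and v = b − b′, w u ≡ v gives w a + b′ ≡ w a′ + b, and w u ≡ −v gives
    -- w a + b ≡ w a′ + b′: either way two sums of the tiling wA ⊕ B coincide.
    sands-ordered : ∀ {xs ys a a′ b b′} → Tiles xs ys → a ∈ xs → a′ ∈ xs → a ≢ a′ → b ∈ ys → b′ ∈ ys →
                    a′ ≤ a → b′ ≤ b → gcd (a ∸ a′) M ≢ gcd (b ∸ b′) M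
    sands-ordered {xs} {ys} {a} {a′} {b} {b′} tiles a∈ a′∈ a≢a′ b∈ b′∈ a′≤a b′≤b gcd≡
      with UnitMultiplier.unit-multiplier M (a ∸ a′) (b ∸ b′) gcd≡
    ... | w , w≢0 , w⊥M , wu≡±v = collide wu≡±v
      where
      instance
        w-nonZero : NonZero w
        w-nonZero = w≢0
      u v : ℕ
      u = a ∸ a′
      v = b ∸ b′
      ∣xs∣∣M : length xs ∣ M
      ∣xs∣∣M = divides (length ys) (trans (sym (tiles⇒length*length≡M xs ys tiles)) (*-comm (length xs) _))
      w-tiles : Tiles (map (w *_) xs) ys
      w-tiles = dilate xs ys (λ ℓ-prime ℓ∣w ℓ∣∣xs∣ → w⊥M ℓ-prime ℓ∣w (∣-trans ℓ∣∣xs∣ ∣xs∣∣M)) tiles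
      wa∈ : w * a ∈ map (w *_) xs
      wa∈ = ∈-map⁺ (w *_) a∈
      wa′∈ : w * a′ ∈ map (w *_) xs
      wa′∈ = ∈-map⁺ (w *_) a′∈
      wa≢wa′ : w * a ≢ w * a′
      wa≢wa′ = a≢a′ ∘ *-cancelˡ-≡ a a′ w
      wa≡ : w * a ≡ w * a′ + w * u
      wa≡ = trans (cong (w *_) (sym (m+[n∸m]≡n a′≤a))) (*-distribˡ-+ w a′ u)
      b≡ : b ≡ b′ + v
      b≡ = sym (m+[n∸m]≡n b′≤b)
      collide : w * u ≡ v mod M ⊎ w * u + v ≡ 0 mod M → ⊥
      collide (inj₁ wu≡v) = tiles⇒sums-distinct w-tiles wa∈ wa′∈ wa≢wa′ b′∈ b∈ (begin
        (w * a + b′) % M                 ≡⟨ cong (λ t → (t + b′) % M) wa≡ ⟩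
        (w * a′ + w * u + b′) % M        ≡⟨ cong (_% M) (+-assoc (w * a′) (w * u) b′) ⟩
        (w * a′ + (w * u + b′)) % M      ≡⟨ +-cong-mod {x = w * a′} refl (+-cong-mod {x = w * u} {x′ = v} {y = b′} wu≡v refl) ⟩
        (w * a′ + (v + b′)) % M          ≡⟨ cong (λ t → (w * a′ + t) % M) (trans (+-comm v b′) (sym b≡)) ⟩
        (w * a′ + b) % M                 ∎)
      collide (inj₂ wu+v≡0) = tiles⇒sums-distinct w-tiles wa∈ wa′∈ wa≢wa′ b∈ b′∈ (begin
        (w * a + b) % M                  ≡⟨ cong₂ (λ s t → (s + t) % M) wa≡ b≡ ⟩
        (w * a′ + w * u + (b′ + v)) % M  ≡⟨ cong (_% M) (interchange (w * a′) (w * u) b′ v) ⟩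
        (w * a′ + b′ + (w * u + v)) % M  ≡⟨ +-cong-mod {x = w * a′ + b′} refl wu+v≡0 ⟩
        (w * a′ + b′ + 0) % M            ≡⟨ cong (_% M) (+-identityʳ _) ⟩
        (w * a′ + b′) % M                ∎)

  sands : ∀ {xs ys a a′ b b′} → Tiles xs ys → a ∈ xs → a′ ∈ xs → a ≢ a′ → b ∈ ys → b′ ∈ ys →
          gcd ∣ a - a′ ∣ M ≢ gcd ∣ b - b′ ∣ M
  sands {a = a} {a′} {b} {b′} tiles a∈ a′∈ a≢a′ b∈ b′∈ with ≤-total a′ a | ≤-total b′ b
  ... | inj₁ a′≤a | inj₁ b′≤b = sands-ordered tiles a∈ a′∈ a≢a′ b∈ b′∈ a′≤a b′≤b
                                  ∘ subst₂ gcd≡ (m≤n⇒∣n-m∣≡n∸m a′≤a) (m≤n⇒∣n-m∣≡n∸m b′≤b)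
  ... | inj₁ a′≤a | inj₂ b≤b′ = sands-ordered tiles a∈ a′∈ a≢a′ b′∈ b∈ a′≤a b≤b′
                                  ∘ subst₂ gcd≡ (m≤n⇒∣n-m∣≡n∸m a′≤a) (m≤n⇒∣m-n∣≡n∸m b≤b′)
  ... | inj₂ a≤a′ | inj₁ b′≤b = sands-ordered tiles a′∈ a∈ (a≢a′ ∘ sym) b∈ b′∈ a≤a′ b′≤b
                                  ∘ subst₂ gcd≡ (m≤n⇒∣m-n∣≡n∸m a≤a′) (m≤n⇒∣n-m∣≡n∸m b′≤b)
  ... | inj₂ a≤a′ | inj₂ b≤b′ = sands-ordered tiles a′∈ a∈ (a≢a′ ∘ sym) b′∈ b∈ a≤a′ b≤b′
                                  ∘ subst₂ gcd≡ (m≤n⇒∣m-n∣≡n∸m a≤a′) (m≤n⇒∣m-n∣≡n∸m b≤b′)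

minList-∈ : ∀ x xs → minList (x ∷ xs) ∈ x ∷ xs
minList-∈ x []       = here refl
minList-∈ x (y ∷ ys) with ⊓-sel x (minList (y ∷ ys))
... | inj₁ x⊓min≡x   = here x⊓min≡x
... | inj₂ x⊓min≡min = there (subst (_∈ y ∷ ys) (sym x⊓min≡min) (minList-∈ y ys))

minList-attained : (h : X → ℕ) → ∀ {xs x} → x ∈ xs → ∃[ y ] y ∈ xs × minList (map h xs) ≡ h y
minList-attained h {y ∷ ys} _ = ∈-map⁻ h (minList-∈ (h y) (map h ys))

length-filter-∈-suc : ∀ {M} x (A : Subset M) xs →
                      length (filter (_∈? (x ∷ A)) (map suc xs)) ≡ length (filter (_∈? A) xs)
length-filter-∈-suc x A []       = refl
length-filter-∈-suc x A (y ∷ xs) with does (y ∈? A)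
... | true  = cong suc (length-filter-∈-suc x A xs)
... | false = length-filter-∈-suc x A xs

∣∣≡length-filter : ∀ {M} (A : Subset M) → ∣ A ∣ ≡ length (filter (_∈? A) (allFin M))
∣∣≡length-filter-suc : ∀ {M} x (A : Subset M) → ∣ A ∣ ≡ length (filter (_∈? (x ∷ A)) (tabulate suc))
∣∣≡length-filter {zero}  []           = refl
∣∣≡length-filter {suc M} (true ∷ A)  = cong suc (∣∣≡length-filter-suc true A)
∣∣≡length-filter {suc M} (false ∷ A) = ∣∣≡length-filter-suc false A

∣∣≡length-filter-suc {M} x A = begin
  ∣ A ∣                                                 ≡⟨ ∣∣≡length-filter A ⟩
  length (filter (_∈? A) (allFin M))                    ≡⟨ length-filter-∈-suc x A (allFin M) ⟨
  length (filter (_∈? (x ∷ A)) (map suc (allFin M)))    ≡⟨ cong (λ xs → length (filter (_∈? (x ∷ A)) xs)) (map-tabulate id suc) ⟩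
  length (filter (_∈? (x ∷ A)) (tabulate suc))          ∎

module Subsets {M : ℕ} where

  elements : Subset M → List (Fin M)
  elements A = filter (_∈? A) (allFin M)

  elements-unique : ∀ A → Unique (elements A)
  elements-unique A = unique-filter⁺ (_∈? A) (allFin⁺ M)

  ∈-elements⁺ : ∀ {A a} → a ∈ₛ A → a ∈ elements A
  ∈-elements⁺ {A} {a} a∈A = ∈-filter⁺ (_∈? A) (∈-allFin a) a∈A

  ∈-elements⁻ : ∀ {A a} → a ∈ elements A → a ∈ₛ A
  ∈-elements⁻ {A} a∈ = proj₂ (∈-filter⁻ (_∈? A) {xs = allFin M} a∈)

  numbers : Subset M → List ℕ
  numbers A = map toℕ (elements A)

  injective⇒≤∣∣ : ∀ {n} (A : Subset M) (f : Fin n → Fin M) → Injective _≡_ _≡_ f → (∀ i → f i ∈ₛ A) → n ≤ ∣ A ∣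
  injective⇒≤∣∣ A f f-injective f∈A = subst (_ ≤_) (sym (∣∣≡length-filter A)) (injective⇒≤ position-injective)
    where
    position : _ → Fin (length (elements A))
    position i = index (∈-elements⁺ (f∈A i))
    position-injective : Injective _≡_ _≡_ position
    position-injective {i} {j} eq = f-injective (begin
      f i                                ≡⟨ lookup-index (∈-elements⁺ (f∈A i)) ⟩
      lookup (elements A) (position i)   ≡⟨ cong (lookup (elements A)) eq ⟩
      lookup (elements A) (position j)   ≡⟨ lookup-index (∈-elements⁺ (f∈A j)) ⟨
      f j                                ∎)

  tiling⇒tiles : .{{_ : NonZero M}} → ∀ {A B} → Tiling M A B → GroupSemiring.Tiles M (numbers A) (numbers B)
  tiling⇒tiles {A} {B} tiling = count≡1⇒≈upTo {numbers A ⊗ numbers B} count≡1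
    where
    open GroupSemiring M
    count≡1 : ∀ {z} → z < M → count z (numbers A ⊗ numbers B) ≡ 1
    count≡1 {z} z<M with proj₁ (tiling (fromℕ< z<M))
    ... | a₀ , b₀ , a₀∈A , b₀∈B , a₀+b₀≡z = begin
      count z (numbers A ⊗ numbers B)                              ≡⟨ count-⊗ z (numbers A) (numbers B) ⟩
      ∑[ x ∈ numbers A ] ∑[ y ∈ numbers B ] δ ((x + y) % M) z     ≡⟨ ∑-map toℕ (elements A) _ ⟩
      ∑[ a ∈ elements A ] ∑[ y ∈ numbers B ] δ ((toℕ a + y) % M) z ≡⟨ ∑-cong (elements A) (λ a → ∑-map toℕ (elements B) _) ⟩
      ∑[ a ∈ elements A ] ∑[ b ∈ elements B ] hit a b             ≡⟨ ∑-single _ (elements-unique A) (∈-elements⁺ a₀∈A) vanishˡ ⟩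
      ∑[ b ∈ elements B ] hit a₀ b                                 ≡⟨ ∑-single _ (elements-unique B) (∈-elements⁺ b₀∈B) vanishʳ ⟩
      hit a₀ b₀                                                    ≡⟨ cong (λ s → δ s z) (trans a₀+b₀≡z (toℕ-fromℕ< z<M)) ⟩
      δ z z                                                        ≡⟨ δ-refl z ⟩
      1                                                            ∎
      where
      hit : Fin M → Fin M → ℕ
      hit a b = δ ((toℕ a + toℕ b) % M) z
      same-pair : ∀ {a b} → a ∈ elements A → b ∈ elements B → (toℕ a + toℕ b) % M ≡ z → a ≡ a₀ × b ≡ b₀
      same-pair {a} {b} a∈ b∈ a+b≡z =
        proj₂ (tiling (fromℕ< z<M)) a a₀ b b₀ (∈-elements⁻ a∈) a₀∈A (∈-elements⁻ b∈) b₀∈B (trans a+b≡z (sym (toℕ-fromℕ< z<M))) a₀+b₀≡z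
      vanishˡ : ∀ {a} → a ∈ elements A → a ≢ a₀ → ∑[ b ∈ elements B ] hit a b ≡ 0
      vanishˡ a∈ a≢a₀ = ∑-zero (elements B) (λ b∈ → δ-≢ (a≢a₀ ∘ proj₁ ∘ same-pair a∈ b∈))
      vanishʳ : ∀ {b} → b ∈ elements B → b ≢ b₀ → hit a₀ b ≡ 0
      vanishʳ b∈ b≢b₀ = δ-≢ (b≢b₀ ∘ proj₂ ∘ same-pair (∈-elements⁺ a₀∈A) b∈)

  ∈Π : ∀ {q} {x y : Fin M} → q ∣ ∣ toℕ x - toℕ y ∣ → y ∈ₛ Π q x
  ∈Π {q} {x} {y} q∣x-y =
    lookup⇒[]= y (Π q x) (trans (lookup∘tabulate (λ y → does (q ∣? ∣ toℕ x - toℕ y ∣)) y) (dec-true (q ∣? _) q∣x-y))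

  mSet-attained : ∀ q A {a} → a ∈ₛ A → ∃[ a₀ ] a₀ ∈ₛ A × mSet q A ≡ ∣ A ∩ Π q a₀ ∣
  mSet-attained q A a∈A with minList-attained (λ a → ∣ A ∩ Π q a ∣) (∈-elements⁺ a∈A)
  ... | a₀ , a₀∈ , min≡ = a₀ , ∈-elements⁻ a₀∈ , min≡

  InDiv? : ∀ A t → Dec (InDiv M A t)
  InDiv? A t = any? (λ a → any? (λ a′ → a ∈? A ×-dec a′ ∈? A ×-dec gcd ∣ toℕ a - toℕ a′ ∣ M ≟ t))

-- The fibre argument

wlog-< : ∀ {n} (R : Fin n → Fin n → Set) → (∀ {i j} → R i j → R j i) →
         (∀ {i j} → toℕ j < toℕ i → R i j) → ∀ {i j} → i ≢ j → R i j
wlog-< R sym-R R-< {i} {j} i≢j with <-cmp (toℕ j) (toℕ i)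
... | tri< j<i _ _ = R-< j<i
... | tri≈ _ j≡i _ = contradiction (toℕ-injective (sym j≡i)) i≢j
... | tri> _ _ i<j = sym-R (R-< i<j)

either-constant : ∀ {n} {A B : Set} → DecidableEquality A → (f : Fin n → A) (g : Fin n → B) →
                   (∀ i j → f i ≡ f j ⊎ g i ≡ g j) → (∀ i j → f i ≡ f j) ⊎ (∀ i j → g i ≡ g j)
either-constant {n} _≟ᴬ_ f g cover with all? (λ i → all? (λ j → f i ≟ᴬ f j))
... | yes f-const = inj₁ f-const
... | no ¬f-const with ¬∀⟶∃¬ n _ (λ i → all? (λ j → f i ≟ᴬ f j)) ¬f-const
...   | i , ¬∀j with ¬∀⟶∃¬ n _ (λ j → f i ≟ᴬ f j) ¬∀j
...     | j , fi≢fj = inj₂ (λ k l → trans (g≡gi k) (sym (g≡gi l)))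
  where
  gi≡gj : g i ≡ g j
  gi≡gj with cover i j
  ... | inj₁ fi≡fj = contradiction fi≡fj fi≢fj
  ... | inj₂ gi≡gj = gi≡gj
  g≡gi : ∀ k → g k ≡ g i
  g≡gi k with cover k i | cover k j
  ... | inj₂ gk≡gi | _           = gk≡gi
  ... | inj₁ _     | inj₂ gk≡gj  = trans gk≡gj (sym gi≡gj)
  ... | inj₁ fk≡fi | inj₁ fk≡fj  = contradiction (trans (sym fk≡fi) fk≡fj) fi≢fj

module FibreBound (M P N n : ℕ) .{{_ : NonZero M}} (P-prime : Prime P) (M≡P*N : M ≡ P * N) (Pⁿ∣M : P ^ n ∣ M)
                  {A B : Subset M} (tiling : Tiling M A B) where

  open GroupSemiring M
  open Sands M
  open Subsets {M}

  Q : ℕ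
  Q = P ^ n

  private
    instance
      P≢0 : NonZero P
      P≢0 = prime⇒nonZero P-prime
      Q≢0 : NonZero Q
      Q≢0 = m^n≢0 P n

  gcd[t*N,M]≡N : ∀ {t} → 0 < t → t < P → gcd (t * N) M ≡ N
  gcd[t*N,M]≡N {t} 0<t t<P = begin
    gcd (t * N) M      ≡⟨ cong₂ gcd (*-comm t N) (trans M≡P*N (*-comm P N)) ⟩
    gcd (N * t) (N * P) ≡⟨ c*gcd[m,n]≡gcd[cm,cn] N t P ⟨
    N * gcd t P        ≡⟨ cong (N *_) (trans (gcd-comm t P) (coprime⇒gcd≡1 (prime⇒coprime P-prime {{>-nonZero 0<t}} t<P))) ⟩
    N * 1              ≡⟨ *-identityʳ N ⟩
    N                  ∎

  gcd∣N : ∀ {x} → Q ∤ x → gcd x M ∣ N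
  gcd∣N {x} Q∤x with P ∣? quotient (gcd[m,n]∣n x M)
  ... | yes (divides h cofactor≡h*P) = divides h (*-cancelˡ-≡ N (h * g) P (begin
    P * N               ≡⟨ M≡P*N ⟨
    M                   ≡⟨ _∣_.equality (gcd[m,n]∣n x M) ⟩
    quotient (gcd[m,n]∣n x M) * g ≡⟨ cong (_* g) cofactor≡h*P ⟩
    h * P * g           ≡⟨ solve 3 (λ h P g → h :* P :* g := P :* (h :* g)) refl h P g ⟩
    P * (h * g)         ∎))
    where
    g : ℕ
    g = gcd x M
    open +-*-Solver
  ... | no P∤cofactor = contradiction (∣-trans Q∣g (gcd[m,n]∣m x M)) Q∤x
    where
    Q∣g : Q ∣ gcd x M
    Q∣g = pⁿ∣h*g⇒pⁿ∣g P-prime P∤cofactor n (subst (Q ∣_) (_∣_.equality (gcd[m,n]∣n x M)) Pⁿ∣M)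

  gcd-shift : ∀ {t u v} → u ≡ v + t * N mod M → Q ∤ u → Q ∤ v → gcd u M ≡ gcd v M
  gcd-shift {t} {u} {v} u≡v+tN Q∤u Q∤v = ∣-antisym
    (gcd-greatest (∣m+n∣m⇒∣n (subst (gcd u M ∣_) (+-comm v (t * N)) gcd[u]∣v+tN) (∣n⇒∣m*n t (gcd∣N Q∤u)))
                  (gcd[m,n]∣n u M))
    (gcd-greatest (∣-resp-mod (gcd[m,n]∣n v M) (∣m∣n⇒∣m+n (gcd[m,n]∣m v M) (∣n⇒∣m*n t (gcd∣N Q∤v))) (sym u≡v+tN))
                  (gcd[m,n]∣n v M))
    where
    gcd[u]∣v+tN : gcd u M ∣ v + t * N
    gcd[u]∣v+tN = ∣-resp-mod (gcd[m,n]∣n u M) (gcd[m,n]∣m u M) u≡v+tN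

  drop-multiple-mod-Q : ∀ {x y s} → y + s ≡ x mod M → Q ∣ s → y ≡ x mod Q
  drop-multiple-mod-Q {x} {y} {s} y+s≡x Q∣s = trans (sym (%-remove-+ʳ y Q∣s)) (≡-mod-∣ {m = M} {x = y + s} {y = x} Pⁿ∣M y+s≡x)

  shift⇒InDiv : ∀ {D : Subset M} {d d′ t} → d ∈ₛ D → d′ ∈ₛ D → 0 < t → t < P →
                toℕ d ≡ toℕ d′ + t * N mod M → InDiv M D N
  shift⇒InDiv {d = d} {d′} d∈D d′∈D 0<t t<P d≡d′+tN =
    d , d′ , d∈D , d′∈D , trans (gcd-∣-∣-mod {x = toℕ d} {y = toℕ d′} (sym d≡d′+tN)) (gcd[t*N,M]≡N 0<t t<P)

  same-fibre : ∀ {a a′ b b′ t} → a ∈ₛ A → a′ ∈ₛ A → b ∈ₛ B → b′ ∈ₛ B → 0 < t → t < P →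
               toℕ a + toℕ b ≡ toℕ a′ + toℕ b′ + t * N mod M → ¬ InDiv M A N → ¬ InDiv M B N →
               toℕ a ≡ toℕ a′ mod Q ⊎ toℕ b ≡ toℕ b′ mod Q
  same-fibre {a} {a′} {b} {b′} {t} a∈A a′∈A b∈B b′∈B 0<t t<P a+b≡a′+b′+tN ¬DivA ¬DivB with a Fin.≟ a′
  ... | yes refl = contradiction (shift⇒InDiv b∈B b′∈B 0<t t<P (cancel-shiftˡ (toℕ a) a+b≡a′+b′+tN)) ¬DivB
  ... | no a≢a′ with difference-mod (toℕ a) (toℕ a′) | difference-mod (toℕ b′) (toℕ b)
  ...   | u , a′+u≡a | v , b+v≡b′ with Q ∣? u | Q ∣? v
  ...     | yes Q∣u | _       = inj₁ (sym (drop-multiple-mod-Q a′+u≡a Q∣u))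
  ...     | no _    | yes Q∣v = inj₂ (drop-multiple-mod-Q b+v≡b′ Q∣v)
  ...     | no Q∤u  | no Q∤v  = contradiction gcd≡ (sands (tiling⇒tiles tiling) (∈-map⁺ toℕ (∈-elements⁺ a∈A))
                                  (∈-map⁺ toℕ (∈-elements⁺ a′∈A)) (a≢a′ ∘ toℕ-injective)
                                  (∈-map⁺ toℕ (∈-elements⁺ b′∈B)) (∈-map⁺ toℕ (∈-elements⁺ b∈B)))
    where
    α α′ β β′ : ℕ
    α = toℕ a
    α′ = toℕ a′
    β = toℕ b
    β′ = toℕ b′
    u≡v+tN : u ≡ v + t * N mod M
    u≡v+tN = +-cancelˡ-mod (α′ + β) {u} {v + t * N} (begin
      (α′ + β + u) % M            ≡⟨ cong (_% M) (xy∙z≈xz∙y α′ β u) ⟩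
      (α′ + u + β) % M            ≡⟨ +-cong-mod {x = α′ + u} {x′ = α} {y = β} a′+u≡a refl ⟩
      (α + β) % M                 ≡⟨ a+b≡a′+b′+tN ⟩
      (α′ + β′ + t * N) % M       ≡⟨ +-cong-mod {x = α′ + β′} {y = t * N} (+-cong-mod {x = α′} {y = β′} {y′ = β + v} refl (sym b+v≡b′)) refl ⟩
      (α′ + (β + v) + t * N) % M  ≡⟨ cong (_% M) (trans (cong (_+ t * N) (sym (+-assoc α′ β v))) (+-assoc (α′ + β) v (t * N))) ⟩
      (α′ + β + (v + t * N)) % M  ∎)
    gcd≡ : gcd ∣ α - α′ ∣ M ≡ gcd ∣ β′ - β ∣ M
    gcd≡ = trans (gcd-∣-∣-mod a′+u≡a) (trans (gcd-shift {t} u≡v+tN Q∤u Q∤v) (sym (gcd-∣-∣-mod b+v≡b′)))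

  module _ {a₀ b₀} (a₀∈A : a₀ ∈ₛ A) (b₀∈B : b₀ ∈ₛ B) (¬DivA : ¬ InDiv M A N) (¬DivB : ¬ InDiv M B N) where

    private
      target : Fin P → ℕ
      target j = toℕ a₀ + toℕ b₀ + toℕ j * N

      decomposition : ∀ j → ∃[ a ] ∃[ b ] (a ∈ₛ A × b ∈ₛ B × (toℕ a + toℕ b) % M ≡ toℕ (fromℕ< (m%n<n (target j) M)))
      decomposition j = proj₁ (tiling (fromℕ< (m%n<n (target j) M)))

      a b : Fin P → Fin M
      a j = proj₁ (decomposition j)
      b j = proj₁ (proj₂ (decomposition j))

      a∈A : ∀ j → a j ∈ₛ A
      a∈A j = proj₁ (proj₂ (proj₂ (decomposition j)))

      b∈B : ∀ j → b j ∈ₛ B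
      b∈B j = proj₁ (proj₂ (proj₂ (proj₂ (decomposition j))))

      a+b≡target : ∀ j → toℕ (a j) + toℕ (b j) ≡ target j mod M
      a+b≡target j = trans (proj₂ (proj₂ (proj₂ (proj₂ (decomposition j))))) (toℕ-fromℕ< _)

      j₀ : Fin P
      j₀ = fromℕ< (>-nonZero⁻¹ P)

      a[j₀]≡a₀ : a j₀ ≡ a₀ × b j₀ ≡ b₀
      a[j₀]≡a₀ = proj₂ (tiling _) (a j₀) a₀ (b j₀) b₀ (a∈A j₀) a₀∈A (b∈B j₀) b₀∈B
        (proj₂ (proj₂ (proj₂ (proj₂ (decomposition j₀)))))
        (begin
          (toℕ a₀ + toℕ b₀) % M                   ≡⟨ cong (_% M) (+-identityʳ _) ⟨
          (toℕ a₀ + toℕ b₀ + 0 * N) % M           ≡⟨ cong (λ k → (toℕ a₀ + toℕ b₀ + k * N) % M) (toℕ-fromℕ< (>-nonZero⁻¹ P)) ⟨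
          target j₀ % M                           ≡⟨ toℕ-fromℕ< (m%n<n (target j₀) M) ⟨
          toℕ (fromℕ< (m%n<n (target j₀) M))     ∎)

      sum-shift : ∀ {j k} → toℕ k < toℕ j →
             toℕ (a j) + toℕ (b j) ≡ toℕ (a k) + toℕ (b k) + (toℕ j ∸ toℕ k) * N mod M
      sum-shift {j} {k} k<j = begin
        (toℕ (a j) + toℕ (b j)) % M                          ≡⟨ a+b≡target j ⟩
        target j % M                                         ≡⟨ cong (_% M) target-step ⟨
        (target k + (toℕ j ∸ toℕ k) * N) % M                  ≡⟨ +-cong-mod {x = target k} {y = (toℕ j ∸ toℕ k) * N} (sym (a+b≡target k)) refl ⟩
        (toℕ (a k) + toℕ (b k) + (toℕ j ∸ toℕ k) * N) % M     ∎
        where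
        target-step : target k + (toℕ j ∸ toℕ k) * N ≡ target j
        target-step = trans (+-assoc (toℕ a₀ + toℕ b₀) _ _)
          (cong (toℕ a₀ + toℕ b₀ +_) (trans (sym (*-distribʳ-+ N (toℕ k) _)) (cong (_* N) (m+[n∸m]≡n (<⇒≤ k<j)))))

      j∸k<P : ∀ (j k : Fin P) → toℕ j ∸ toℕ k < P
      j∸k<P j k = ≤-<-trans (m∸n≤m (toℕ j) (toℕ k)) (toℕ<n j)

      injective-if-steps : (f : Fin P → Fin M) → (∀ {j k} → toℕ k < toℕ j → f j ≢ f k) → Injective _≡_ _≡_ f
      injective-if-steps f distinct {j} {k} f[j]≡f[k] with j Fin.≟ k
      ... | yes j≡k = j≡k
      ... | no  j≢k = contradiction f[j]≡f[k] (wlog-< (λ j k → f j ≢ f k) (λ f≢ → f≢ ∘ sym) distinct j≢k)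

      a-injective : Injective _≡_ _≡_ a
      a-injective = injective-if-steps a λ {j} {k} k<j a[j]≡a[k] → ¬DivB (shift⇒InDiv (b∈B j) (b∈B k) (m<n⇒0<n∸m k<j) (j∸k<P j k)
        (cancel-shiftˡ (toℕ (a j))
          (subst (λ c → toℕ (a j) + toℕ (b j) ≡ toℕ c + toℕ (b k) + (toℕ j ∸ toℕ k) * N mod M) (sym a[j]≡a[k]) (sum-shift k<j))))

      b-injective : Injective _≡_ _≡_ b
      b-injective = injective-if-steps b λ {j} {k} k<j b[j]≡b[k] → ¬DivA (shift⇒InDiv (a∈A j) (a∈A k) (m<n⇒0<n∸m k<j) (j∸k<P j k)
        (cancel-shiftʳ (toℕ (b j)) {x′ = toℕ (a k)} {s = (toℕ j ∸ toℕ k) * N}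
          (subst (λ c → toℕ (a j) + toℕ (b j) ≡ toℕ (a k) + toℕ c + (toℕ j ∸ toℕ k) * N mod M) (sym b[j]≡b[k]) (sum-shift k<j))))

      residues-cover : ∀ j k → toℕ (a j) ≡ toℕ (a k) mod Q ⊎ toℕ (b j) ≡ toℕ (b k) mod Q
      residues-cover j k with j Fin.≟ k
      ... | yes refl = inj₁ refl
      ... | no  j≢k  = wlog-< (λ j k → toℕ (a j) ≡ toℕ (a k) mod Q ⊎ toℕ (b j) ≡ toℕ (b k) mod Q) (Sum.map sym sym)
        (λ {j} {k} k<j → same-fibre (a∈A j) (a∈A k) (b∈B j) (b∈B k) (m<n⇒0<n∸m k<j) (j∸k<P j k) (sum-shift k<j) ¬DivA ¬DivB) j≢k

      fibre-of : ∀ {D : Subset M} {d₀} (f : Fin P → Fin M) → Injective _≡_ _≡_ f → (∀ j → f j ∈ₛ D) → f j₀ ≡ d₀ →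
                 (∀ j k → toℕ (f j) ≡ toℕ (f k) mod Q) → P ≤ ∣ D ∩ Π Q d₀ ∣
      fibre-of {D} {d₀} f f-injective f∈D f[j₀]≡d₀ f-const =
        injective⇒≤∣∣ (D ∩ Π Q d₀) f f-injective (λ j → x∈p∩q⁺ (f∈D j , ∈Π {x = d₀} (≡-mod⇒∣∣-∣ {m = Q} {x = toℕ d₀} {y = toℕ (f j)}
          (subst (λ d → toℕ d ≡ toℕ (f j) mod Q) f[j₀]≡d₀ (f-const j₀ j)))))

    fibre-bound : P ≤ ∣ A ∩ Π Q a₀ ∣ ⊎ P ≤ ∣ B ∩ Π Q b₀ ∣
    fibre-bound with either-constant _≟_ (λ j → toℕ (a j) % Q) (λ j → toℕ (b j) % Q) residues-cover
    ... | inj₁ a-const = inj₁ (fibre-of a a-injective a∈A (proj₁ a[j₀]≡a₀) a-const)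
    ... | inj₂ b-const = inj₂ (fibre-of b b-injective b∈B (proj₂ a[j₀]≡a₀) b-const)

  private
    A-nonempty : ∃[ a ] a ∈ₛ A
    A-nonempty with proj₁ (tiling (fromℕ< (>-nonZero⁻¹ M)))
    ... | a , _ , a∈A , _ = a , a∈A

    B-nonempty : ∃[ b ] b ∈ₛ B
    B-nonempty with proj₁ (tiling (fromℕ< (>-nonZero⁻¹ M)))
    ... | _ , b , _ , b∈B , _ = b , b∈B

  N∈Div[A]∪Div[B] : mSet Q A ⊔ mSet Q B < P → InDiv M A N ⊎ InDiv M B N
  N∈Div[A]∪Div[B] m<P with InDiv? A N | InDiv? B N
  ... | yes N∈DivA | _          = inj₁ N∈DivA
  ... | no  _      | yes N∈DivB = inj₂ N∈DivB
  ... | no  N∉DivA | no  N∉DivB with mSet-attained Q A (proj₂ A-nonempty) | mSet-attained Q B (proj₂ B-nonempty)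
  ...   | a₀ , a₀∈A , mA≡ | b₀ , b₀∈B , mB≡ with fibre-bound a₀∈A b₀∈B N∉DivA N∉DivB
  ...     | inj₁ P≤∣A∩Π∣ = contradiction (≤-trans P≤∣A∩Π∣ (≤-trans (≤-reflexive (sym mA≡)) (m≤m⊔n _ _))) (<⇒≱ m<P)
  ...     | inj₂ P≤∣B∩Π∣ = contradiction (≤-trans P≤∣B∩Π∣ (≤-trans (≤-reflexive (sym mB≡)) (m≤n⊔m _ _))) (<⇒≱ m<P)


factor∣prodFin : ∀ {d} (f : Fin d → ℕ) i → f i ∣ prodFin d f
factor∣prodFin f zero    = m∣m*n _
factor∣prodFin f (suc i) = ∣n⇒∣m*n (f zero) (factor∣prodFin (f ∘ suc) i)

theorem6p1 : (d : ℕ) (p n : Fin (suc d) → ℕ) (M : ℕ) .{{_ : NonZero M}} .{{_ : NonZero (p (fromℕ d))}} →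
    (∀ i → Prime (p i)) → Injective _≡_ _≡_ p → (1 ≤ n (fromℕ d)) →
    M ≡ prodFin (suc d) (λ i → p i ^ n i) →
    (A B : Subset M) → Tiling M A B →
    mSet (p (fromℕ d) ^ n (fromℕ d)) A ⊔ mSet (p (fromℕ d) ^ n (fromℕ d)) B < p (fromℕ d) →
    InDiv M A (M / p (fromℕ d)) ⊎ InDiv M B (M / p (fromℕ d))
theorem6p1 d p n M p-prime _ 1≤n M≡∏ A B tiling m<P =
  FibreBound.N∈Div[A]∪Div[B] M P (M / P) (n (fromℕ d)) (p-prime (fromℕ d)) M≡P*N Q∣M tiling m<P
  where
  P Q : ℕ
  P = p (fromℕ d)
  Q = P ^ n (fromℕ d)
  Q∣M : Q ∣ M
  Q∣M = subst (Q ∣_) (sym M≡∏) (factor∣prodFin (λ i → p i ^ n i) (fromℕ d))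
  M≡P*N : M ≡ P * (M / P)
  M≡P*N = sym (m*[n/m]≡n {{prime⇒nonZero (p-prime (fromℕ d))}} (∣-trans (m∣m^n 1≤n) Q∣M))
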